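{- Orchestrator respectfulness is decidable: there is an algorithm which, given an orchestrator $f$, decides whether $f$ is respectful.
   Context: Names: a countable set $\mathcal N$; co-names $\overline a$ for $a\in\mathcal N$. Orchestration actions: $\iota_L::=\langle a,\varepsilon\rangle\mid\langle a,\overline a\rangle$, $\iota_R::=\langle\varepsilon,a\rangle\mid\langle\overline a,a\rangle$, $o::=\langle\overline a,\varepsilon\rangle\mid\langle\varepsilon,\overline a\rangle$ ($a\in\mathcal N$). Orchestrators: closed terms of $f::=\mathbf 1\mid\iota_L.f_1\vee\cdots\vee\iota_L.f_n\mid\iota_R.f_1\vee\cdots\vee\iota_R.f_n\mid o.f\mid x\mid\mathrm{rec}\,x.f$ ($n\ge1$, body of $\mathrm{rec}$ not a variable), with $\mathrm{rec}\,x.f$ identified with $f\{\mathrm{rec}\,x.f/x\}$. Transitions: $\mu.f\xrightarrow{\mu}f$; if $f\xrightarrow{\mu}f'$ then $f\vee g\xrightarrow{\mu}f'$ and $g\vee f\xrightarrow{\mu}f'$. Traces of $f$: finite or infinite sequences $\mu_1\mu_2\cdots$ with $f\xrightarrow{\mu_1}f_1\xrightarrow{\mu_2}\cdots$. Maximal traces: finite traces leading to an $f'$ with no transition, together with all infinite traces. Buffers and respectfulness. A buffer assigns to each name $a$ two integers $c_a$ (client-to-server count) and $s_a$ (server-to-client count); the empty buffer has all counts $0$. Effect of actions: $\langle a,\varepsilon\rangle$ increments $c_a$; $\langle\varepsilon,\overline a\rangle$ decrements $c_a$; $\langle\varepsilon,a\rangle$ increments $s_a$; $\langle\overline a,\varepsilon\rangle$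 decrements $s_a$; $\langle a,\overline a\rangle$, $\langle\overline a,a\rangle$ leave it unchanged. For a sequence $\vec\mu$ and $a\in\mathcal N$, $\vec\mu\!\upharpoonright_a$ is the subsequence of the occurrences of $\langle a,\varepsilon\rangle$ and $\langle\varepsilon,\overline a\rangle$. For a set $S$ of actions, $\vec\mu$ is definitely-$S$ if there is $k$ such that every element of $\vec\mu$ at position $m\ge k$ lies in $S$. A sequence $\vec\mu$ is: sound if for every $a$ and every prefix $\mu_1\cdots\mu_n$ ($n\le|\vec\mu|$), applying it to the empty buffer yields $c_a\ge0$ and $s_a\ge0$; client-respectful if for every $a$, either $\vec\mu\!\upharpoonright_a$ is finite and the value of $c_a$ after $\vec\mu$ (applied to the empty buffer; eventually constant if $\vec\mu$ is infinite) is $0$, or $\vec\mu\!\upharpoonright_a$ is infinite and not definitely-$\{\langle a,\varepsilon\rangle\}$; non-definitely server-inputted if, when $\vec\mu$ is infinite, it is not definitely-$\{\langle\varepsilon,a\rangle\mid a\in\mathcal N\}$; respectful if it is sound, client-respectful and non-definitely server-inputted. An orchestrator $f$ is respectful if every maximal trace of $f$ is respectful. -}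

module Defs where

open import Data.Nat using (ℕ; zero; suc; _≤_)
open import Data.Fin using (Fin; zero; suc)
open import Data.Integer as ℤ using (ℤ; +_; -[1+_]; -_)
open import Data.List using (List; []; _∷_; length; take; applyUpTo; foldr)
open import Data.Product using (Σ; ∃; _×_; _,_)
open import Data.Sum using (_⊎_)
open import Relation.Nullary using (¬_)
open import Relation.Binary.PropositionalEquality using (_≡_)

Name : Set
Name = ℕ

data Act : Set where
  ⟨_,ε⟩  : Name → Act
  syncL  : Name → Act   -- ⟨a,ā⟩   (client-server synchronisation, ι_L)
  ⟨ε,_⟩  : Name → Act
  syncR  : Name → Act   -- ⟨ā,a⟩   (ι_R)
  ⟨~_,ε⟩ : Name → Act   -- ⟨ā,ε⟩
  ⟨ε,~_⟩ : Name → Act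

data ActL : Set where
  inε   : Name → ActL
  inSyn : Name → ActL

data ActR : Set where
  εin   : Name → ActR
  synIn : Name → ActR

data ActO : Set where
  outε : Name → ActO
  εout : Name → ActO

embL : ActL → Act
embL (inε a)   = ⟨ a ,ε⟩
embL (inSyn a) = syncL a

embR : ActR → Act
embR (εin a)   = ⟨ε, a ⟩
embR (synIn a) = syncR a

embO : ActO → Act
embO (outε a) = ⟨~ a ,ε⟩
embO (εout a) = ⟨ε,~ a ⟩

-- Orchestrator terms, de Bruijn style (Tm n = terms with n free vars).
-- The n-ary choices ι.f₁ ∨ ⋯ ∨ ι.fₙ (n ≥ 1) are non-empty lists.

mutual
  data Tm (n : ℕ) : Set where
    𝟏    : Tm n
    sumL : SumL n → Tm n
    sumR : SumR n → Tm n
    out  : ActO → Tm n → Tm n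
    var  : Fin n → Tm n
    rec  : Tm (suc n) → Tm n

  data SumL (n : ℕ) : Set where
    [_∙_]   : ActL → Tm n → SumL n
    _∙_∨_   : ActL → Tm n → SumL n → SumL n

  data SumR (n : ℕ) : Set where
    [_∙_]   : ActR → Tm n → SumR n
    _∙_∨_   : ActR → Tm n → SumR n → SumR n

ext : ∀ {n m} → (Fin n → Fin m) → Fin (suc n) → Fin (suc m)
ext ρ zero    = zero
ext ρ (suc i) = suc (ρ i)

mutual
  ren : ∀ {n m} → (Fin n → Fin m) → Tm n → Tm m
  ren ρ 𝟏         = 𝟏
  ren ρ (sumL s)  = sumL (renL ρ s)
  ren ρ (sumR s)  = sumR (renR ρ s)
  ren ρ (out o t) = out o (ren ρ t)
  ren ρ (var i)   = var (ρ i)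
  ren ρ (rec t)   = rec (ren (ext ρ) t)

  renL : ∀ {n m} → (Fin n → Fin m) → SumL n → SumL m
  renL ρ [ μ ∙ t ]   = [ μ ∙ ren ρ t ]
  renL ρ (μ ∙ t ∨ s) = μ ∙ ren ρ t ∨ renL ρ s

  renR : ∀ {n m} → (Fin n → Fin m) → SumR n → SumR m
  renR ρ [ μ ∙ t ]   = [ μ ∙ ren ρ t ]
  renR ρ (μ ∙ t ∨ s) = μ ∙ ren ρ t ∨ renR ρ s

exts : ∀ {n m} → (Fin n → Tm m) → Fin (suc n) → Tm (suc m)
exts σ zero    = var zero
exts σ (suc i) = ren suc (σ i)

mutual
  sub : ∀ {n m} → (Fin n → Tm m) → Tm n → Tm m
  sub σ 𝟏         = 𝟏
  sub σ (sumL s)  = sumL (subL σ s)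
  sub σ (sumR s)  = sumR (subR σ s)
  sub σ (out o t) = out o (sub σ t)
  sub σ (var i)   = σ i
  sub σ (rec t)   = rec (sub (exts σ) t)

  subL : ∀ {n m} → (Fin n → Tm m) → SumL n → SumL m
  subL σ [ μ ∙ t ]   = [ μ ∙ sub σ t ]
  subL σ (μ ∙ t ∨ s) = μ ∙ sub σ t ∨ subL σ s

  subR : ∀ {n m} → (Fin n → Tm m) → SumR n → SumR m
  subR σ [ μ ∙ t ]   = [ μ ∙ sub σ t ]
  subR σ (μ ∙ t ∨ s) = μ ∙ sub σ t ∨ subR σ s

_[_/0] : ∀ {n} → Tm (suc n) → Tm n → Tm n
t [ u /0] = sub σ t
  where
  σ : _ → _
  σ zero    = u
  σ (suc i) = var i

unfold : ∀ {n} → Tm (suc n) → Tm n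
unfold t = t [ rec t /0]

mutual
  data WF {n : ℕ} : Tm n → Set where
    wf𝟏   : WF 𝟏
    wfL   : ∀ {s} → WFL s → WF (sumL s)
    wfR   : ∀ {s} → WFR s → WF (sumR s)
    wfOut : ∀ {o t} → WF t → WF (out o t)
    wfVar : ∀ {i} → WF (var i)
    wfRec : ∀ {t} → NotVar t → WF t → WF (rec t)

  data WFL {n : ℕ} : SumL n → Set where
    wf[] : ∀ {μ t} → WF t → WFL [ μ ∙ t ]
    wf∨  : ∀ {μ t s} → WF t → WFL s → WFL (μ ∙ t ∨ s)

  data WFR {n : ℕ} : SumR n → Set where
    wf[] : ∀ {μ t} → WF t → WFR [ μ ∙ t ]
    wf∨  : ∀ {μ t s} → WF t → WFR s → WFR (μ ∙ t ∨ s)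

  data NotVar {n : ℕ} : Tm n → Set where
    nv𝟏   : NotVar 𝟏
    nvL   : ∀ {s} → NotVar (sumL s)
    nvR   : ∀ {s} → NotVar (sumR s)
    nvOut : ∀ {o t} → NotVar (out o t)
    nvRec : ∀ {t} → NotVar (rec t)

record Orchestrator : Set where
  constructor orch
  field
    term : Tm 0
    wf   : WF term

-- Labelled transitions on closed terms.
-- μ.f —μ→ f ; a choice moves via any of its summands
-- (f ∨ g —μ→ f' if f —μ→ f' or g —μ→ f');
-- rec x.f is identified with f{rec x.f/x}, so it has exactly the
-- transitions of its unfolding.

data _—[_]→_ : Tm 0 → Act → Tm 0 → Set
data StepL : SumL 0 → Act → Tm 0 → Set
data StepR : SumR 0 → Act → Tm 0 → Set

data _—[_]→_ where
  stL   : ∀ {s μ t}  → StepL s μ t → sumL s —[ μ ]→ t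
  stR   : ∀ {s μ t}  → StepR s μ t → sumR s —[ μ ]→ t
  stOut : ∀ {o t}    → out o t —[ embO o ]→ t
  stRec : ∀ {b μ t}  → unfold b —[ μ ]→ t → rec b —[ μ ]→ t

data StepL where
  single : ∀ {ι t}   → StepL [ ι ∙ t ] (embL ι) t
  here   : ∀ {ι t s} → StepL (ι ∙ t ∨ s) (embL ι) t
  there  : ∀ {ι t s μ u} → StepL s μ u → StepL (ι ∙ t ∨ s) μ u

data StepR where
  single : ∀ {ι t}   → StepR [ ι ∙ t ] (embR ι) t
  here   : ∀ {ι t s} → StepR (ι ∙ t ∨ s) (embR ι) t
  there  : ∀ {ι t s μ u} → StepR s μ u → StepR (ι ∙ t ∨ s) μ u

data _—[_]→*_ : Tm 0 → List Act → Tm 0 → Set where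
  done : ∀ {f} → f —[ [] ]→* f
  step : ∀ {f μ g μs h} → f —[ μ ]→ g → g —[ μs ]→* h → f —[ μ ∷ μs ]→* h

Stuck : Tm 0 → Set
Stuck g = ¬ (Σ Act λ μ → Σ (Tm 0) λ g' → g —[ μ ]→ g')

record InfRun (f : Tm 0) : Set where
  field
    states : ℕ → Tm 0
    acts   : ℕ → Act
    start  : states 0 ≡ f
    steps  : ∀ i → states i —[ acts i ]→ states (suc i)

private
  ind : Name → Name → ℤ
  ind a b with a Data.Nat.≟ b
  ... | Relation.Nullary.yes _ = + 1
  ... | Relation.Nullary.no  _ = + 0

cEff : Name → Act → ℤ
cEff a ⟨ b ,ε⟩  = ind a b
cEff a ⟨ε,~ b ⟩  = - ind a b
cEff a _        = + 0

sEff : Name → Act → ℤ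
sEff a ⟨ε, b ⟩  = ind a b
sEff a ⟨~ b ,ε⟩  = - ind a b
sEff a _        = + 0

cVal : Name → List Act → ℤ
cVal a = foldr (λ μ z → cEff a μ ℤ.+ z) (+ 0)

sVal : Name → List Act → ℤ
sVal a = foldr (λ μ z → sEff a μ ℤ.+ z) (+ 0)

-- μ occurs in  ⃗μ↾a
Rel : Name → Act → Set
Rel a μ = (μ ≡ ⟨ a ,ε⟩) ⊎ (μ ≡ ⟨ε,~ a ⟩)

prefix : (ℕ → Act) → ℕ → List Act
prefix μ n = applyUpTo μ n

SoundL : List Act → Set
SoundL s = ∀ a n → n ≤ length s →
           (+ 0 ℤ.≤ cVal a (take n s)) × (+ 0 ℤ.≤ sVal a (take n s))

-- for a finite sequence, ⃗μ↾a is always finite, so client-respectfulness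
-- says that the final value of c_a is 0
ClientRespL : List Act → Set
ClientRespL s = ∀ a → cVal a s ≡ + 0

-- "non-definitely server-inputted" holds vacuously for finite sequences
RespectfulL : List Act → Set
RespectfulL s = SoundL s × ClientRespL s

SoundI : (ℕ → Act) → Set
SoundI μ = ∀ a n → (+ 0 ℤ.≤ cVal a (prefix μ n)) × (+ 0 ℤ.≤ sVal a (prefix μ n))

RestrFinite : Name → (ℕ → Act) → Set
RestrFinite a μ = ∃ λ k → ∀ m → k ≤ m → ¬ Rel a (μ m)

RestrDefinitelyIn : Name → (ℕ → Act) → Set
RestrDefinitelyIn a μ = ∃ λ k → ∀ m → k ≤ m → Rel a (μ m) → μ m ≡ ⟨ a ,ε⟩

-- client-respectful (for each a, the two cases "↾a finite" and
-- "↾a infinite (= not finite)" with their respective requirements;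
-- the eventual value of c_a is its value at any k after which no
-- element of ↾a occurs)
ClientRespI : (ℕ → Act) → Set
ClientRespI μ = ∀ a →
    (∀ k → (∀ m → k ≤ m → ¬ Rel a (μ m)) → cVal a (prefix μ k) ≡ + 0)
  × (¬ RestrFinite a μ → ¬ RestrDefinitelyIn a μ)

NonDefServerInput : (ℕ → Act) → Set
NonDefServerInput μ = ¬ (∃ λ k → ∀ m → k ≤ m → ∃ λ b → μ m ≡ ⟨ε, b ⟩)

RespectfulI : (ℕ → Act) → Set
RespectfulI μ = SoundI μ × ClientRespI μ × NonDefServerInput μ

Respectful : Orchestrator → Set
Respectful (orch f _) =
    (∀ s g → f —[ s ]→* g → Stuck g → RespectfulL s)
  × (∀ (r : InfRun f) → RespectfulI (InfRun.acts r))

-- Although an orchestrator f is a term with recursion, the terms it can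
-- reach form a finite set: each is a closed instance sub σ t of a
-- non-variable subterm t of f, σ being fixed by the rec-binders above t.
-- So f has the same maximal traces as a finite labelled graph (N nodes,
-- start node st), and respectfulness of f is respectfulness of the finite
-- paths into stuck nodes and of the infinite runs of that graph.  For a
-- finite graph this is equivalent to the following conditions, each of which
-- only involves paths and cycles of length at most N and is therefore
-- decidable by exhaustive search (only finitely many names a matter):
--   C1  no path from st has a negative c_a- or s_a-balance;
--   C2  every path from st into a stuck node has c_a-balance 0;
--   C3  every path from st into a node from which a run can avoid ⟨a,ε⟩
--       and ⟨ε,ā⟩ forever has c_a-balance 0;
--   C4  no reachable cycle contains ⟨a,ε⟩ but no ⟨ε,ā⟩;
--   C5  no reachable non-empty cycle consists of server inputs ⟨ε,b⟩ only.

module Submission where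

open import Defs
open import Data.Nat as ℕ using (ℕ; zero; suc; _≤_; _<_; z≤n; s≤s)
import Data.Nat.Properties as ℕP
open import Data.Fin as F using (Fin; zero; suc; toℕ)
import Data.Fin.Properties as FP
open import Data.Integer as ℤ using (ℤ; +_; -[1+_])
import Data.Integer.Properties as ℤP
open import Data.List using (List; []; _∷_; length; _++_; foldr; take; lookup; map; concatMap; allFin; applyUpTo)
import Data.List.Properties as LP
open import Data.List.Membership.Propositional using (_∈_; _∉_; mapWith∈; find; lose)
open import Data.List.Membership.Propositional.Properties
  using (∈-++⁺ˡ; ∈-++⁺ʳ; ∈-++⁻; ∈-∃++; ∈-map⁺; ∈-concatMap⁺; ∈-allFin; ∈-lookup)
open import Data.List.Relation.Unary.Any as Any using (Any; here; there)
import Data.List.Relation.Unary.Any.Properties as AnyP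
open import Data.List.Relation.Unary.All as All using (All; []; _∷_)
import Data.List.Relation.Unary.All.Properties as AllP
open import Data.Product using (Σ; ∃; _×_; _,_; proj₁; proj₂)
open import Data.Sum using (_⊎_; inj₁; inj₂)
open import Data.Empty using (⊥; ⊥-elim)
open import Data.Unit using (⊤; tt)
open import Function using (_∘_; id)
open import Relation.Nullary using (¬_; Dec; yes; no)
open import Relation.Nullary.Decidable using (_×-dec_; _⊎-dec_; _→-dec_; ¬?; map′)
open import Relation.Binary.PropositionalEquality

module Substitution where

  ext-cong : ∀ {n m} {ρ ρ' : Fin n → Fin m} → ρ ≗ ρ' → ext ρ ≗ ext ρ'
  ext-cong h zero    = refl
  ext-cong h (suc i) = cong suc (h i)

  exts-cong : ∀ {n m} {σ σ' : Fin n → Tm m} → σ ≗ σ' → exts σ ≗ exts σ'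
  exts-cong h zero    = refl
  exts-cong h (suc i) = cong (ren suc) (h i)

  mutual
    ren-cong : ∀ {n m} {ρ ρ' : Fin n → Fin m} → ρ ≗ ρ' → ∀ t → ren ρ t ≡ ren ρ' t
    ren-cong h 𝟏         = refl
    ren-cong h (sumL s)  = cong sumL (renL-cong h s)
    ren-cong h (sumR s)  = cong sumR (renR-cong h s)
    ren-cong h (out o t) = cong (out o) (ren-cong h t)
    ren-cong h (var i)   = cong var (h i)
    ren-cong h (rec t)   = cong rec (ren-cong (ext-cong h) t)

    renL-cong : ∀ {n m} {ρ ρ' : Fin n → Fin m} → ρ ≗ ρ' → ∀ s → renL ρ s ≡ renL ρ' s
    renL-cong h [ μ ∙ t ]   = cong [ μ ∙_] (ren-cong h t)
    renL-cong h (μ ∙ t ∨ s) = cong₂ (μ ∙_∨_) (ren-cong h t) (renL-cong h s)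

    renR-cong : ∀ {n m} {ρ ρ' : Fin n → Fin m} → ρ ≗ ρ' → ∀ s → renR ρ s ≡ renR ρ' s
    renR-cong h [ μ ∙ t ]   = cong [ μ ∙_] (ren-cong h t)
    renR-cong h (μ ∙ t ∨ s) = cong₂ (μ ∙_∨_) (ren-cong h t) (renR-cong h s)

  mutual
    sub-cong : ∀ {n m} {σ σ' : Fin n → Tm m} → σ ≗ σ' → ∀ t → sub σ t ≡ sub σ' t
    sub-cong h 𝟏         = refl
    sub-cong h (sumL s)  = cong sumL (subL-cong h s)
    sub-cong h (sumR s)  = cong sumR (subR-cong h s)
    sub-cong h (out o t) = cong (out o) (sub-cong h t)
    sub-cong h (var i)   = h i
    sub-cong h (rec t)   = cong rec (sub-cong (exts-cong h) t)

    subL-cong : ∀ {n m} {σ σ' : Fin n → Tm m} → σ ≗ σ' → ∀ s → subL σ s ≡ subL σ' s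
    subL-cong h [ μ ∙ t ]   = cong [ μ ∙_] (sub-cong h t)
    subL-cong h (μ ∙ t ∨ s) = cong₂ (μ ∙_∨_) (sub-cong h t) (subL-cong h s)

    subR-cong : ∀ {n m} {σ σ' : Fin n → Tm m} → σ ≗ σ' → ∀ s → subR σ s ≡ subR σ' s
    subR-cong h [ μ ∙ t ]   = cong [ μ ∙_] (sub-cong h t)
    subR-cong h (μ ∙ t ∨ s) = cong₂ (μ ∙_∨_) (sub-cong h t) (subR-cong h s)

  mutual
    ren-ren : ∀ {n m k} (ρ : Fin n → Fin m) (ρ' : Fin m → Fin k) t →
              ren ρ' (ren ρ t) ≡ ren (ρ' ∘ ρ) t
    ren-ren ρ ρ' 𝟏         = refl
    ren-ren ρ ρ' (sumL s)  = cong sumL (renL-ren ρ ρ' s)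
    ren-ren ρ ρ' (sumR s)  = cong sumR (renR-ren ρ ρ' s)
    ren-ren ρ ρ' (out o t) = cong (out o) (ren-ren ρ ρ' t)
    ren-ren ρ ρ' (var i)   = refl
    ren-ren ρ ρ' (rec t)   =
      cong rec (trans (ren-ren (ext ρ) (ext ρ') t) (ren-cong (λ { zero → refl ; (suc i) → refl }) t))

    renL-ren : ∀ {n m k} (ρ : Fin n → Fin m) (ρ' : Fin m → Fin k) s →
               renL ρ' (renL ρ s) ≡ renL (ρ' ∘ ρ) s
    renL-ren ρ ρ' [ μ ∙ t ]   = cong [ μ ∙_] (ren-ren ρ ρ' t)
    renL-ren ρ ρ' (μ ∙ t ∨ s) = cong₂ (μ ∙_∨_) (ren-ren ρ ρ' t) (renL-ren ρ ρ' s)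

    renR-ren : ∀ {n m k} (ρ : Fin n → Fin m) (ρ' : Fin m → Fin k) s →
               renR ρ' (renR ρ s) ≡ renR (ρ' ∘ ρ) s
    renR-ren ρ ρ' [ μ ∙ t ]   = cong [ μ ∙_] (ren-ren ρ ρ' t)
    renR-ren ρ ρ' (μ ∙ t ∨ s) = cong₂ (μ ∙_∨_) (ren-ren ρ ρ' t) (renR-ren ρ ρ' s)

  mutual
    sub-ren : ∀ {n m k} (ρ : Fin n → Fin m) (τ : Fin m → Tm k) t →
              sub τ (ren ρ t) ≡ sub (τ ∘ ρ) t
    sub-ren ρ τ 𝟏         = refl
    sub-ren ρ τ (sumL s)  = cong sumL (subL-ren ρ τ s)
    sub-ren ρ τ (sumR s)  = cong sumR (subR-ren ρ τ s)
    sub-ren ρ τ (out o t) = cong (out o) (sub-ren ρ τ t)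
    sub-ren ρ τ (var i)   = refl
    sub-ren ρ τ (rec t)   =
      cong rec (trans (sub-ren (ext ρ) (exts τ) t) (sub-cong (λ { zero → refl ; (suc i) → refl }) t))

    subL-ren : ∀ {n m k} (ρ : Fin n → Fin m) (τ : Fin m → Tm k) s →
               subL τ (renL ρ s) ≡ subL (τ ∘ ρ) s
    subL-ren ρ τ [ μ ∙ t ]   = cong [ μ ∙_] (sub-ren ρ τ t)
    subL-ren ρ τ (μ ∙ t ∨ s) = cong₂ (μ ∙_∨_) (sub-ren ρ τ t) (subL-ren ρ τ s)

    subR-ren : ∀ {n m k} (ρ : Fin n → Fin m) (τ : Fin m → Tm k) s →
               subR τ (renR ρ s) ≡ subR (τ ∘ ρ) s
    subR-ren ρ τ [ μ ∙ t ]   = cong [ μ ∙_] (sub-ren ρ τ t)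
    subR-ren ρ τ (μ ∙ t ∨ s) = cong₂ (μ ∙_∨_) (sub-ren ρ τ t) (subR-ren ρ τ s)

  mutual
    ren-sub : ∀ {n m k} (σ : Fin n → Tm m) (ρ : Fin m → Fin k) t →
              ren ρ (sub σ t) ≡ sub (ren ρ ∘ σ) t
    ren-sub σ ρ 𝟏         = refl
    ren-sub σ ρ (sumL s)  = cong sumL (renL-sub σ ρ s)
    ren-sub σ ρ (sumR s)  = cong sumR (renR-sub σ ρ s)
    ren-sub σ ρ (out o t) = cong (out o) (ren-sub σ ρ t)
    ren-sub σ ρ (var i)   = refl
    ren-sub σ ρ (rec t)   = cong rec (trans (ren-sub (exts σ) (ext ρ) t) (sub-cong under-binder t))
      where
      under-binder : ren (ext ρ) ∘ exts σ ≗ exts (ren ρ ∘ σ)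
      under-binder zero    = refl
      under-binder (suc i) = trans (ren-ren suc (ext ρ) (σ i)) (sym (ren-ren ρ suc (σ i)))

    renL-sub : ∀ {n m k} (σ : Fin n → Tm m) (ρ : Fin m → Fin k) s →
               renL ρ (subL σ s) ≡ subL (ren ρ ∘ σ) s
    renL-sub σ ρ [ μ ∙ t ]   = cong [ μ ∙_] (ren-sub σ ρ t)
    renL-sub σ ρ (μ ∙ t ∨ s) = cong₂ (μ ∙_∨_) (ren-sub σ ρ t) (renL-sub σ ρ s)

    renR-sub : ∀ {n m k} (σ : Fin n → Tm m) (ρ : Fin m → Fin k) s →
               renR ρ (subR σ s) ≡ subR (ren ρ ∘ σ) s
    renR-sub σ ρ [ μ ∙ t ]   = cong [ μ ∙_] (ren-sub σ ρ t)
    renR-sub σ ρ (μ ∙ t ∨ s) = cong₂ (μ ∙_∨_) (ren-sub σ ρ t) (renR-sub σ ρ s)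

  mutual
    sub-sub : ∀ {n m k} (σ : Fin n → Tm m) (τ : Fin m → Tm k) t →
              sub τ (sub σ t) ≡ sub (sub τ ∘ σ) t
    sub-sub σ τ 𝟏         = refl
    sub-sub σ τ (sumL s)  = cong sumL (subL-sub σ τ s)
    sub-sub σ τ (sumR s)  = cong sumR (subR-sub σ τ s)
    sub-sub σ τ (out o t) = cong (out o) (sub-sub σ τ t)
    sub-sub σ τ (var i)   = refl
    sub-sub σ τ (rec t)   = cong rec (trans (sub-sub (exts σ) (exts τ) t) (sub-cong under-binder t))
      where
      under-binder : sub (exts τ) ∘ exts σ ≗ exts (sub τ ∘ σ)
      under-binder zero    = refl
      under-binder (suc i) = trans (sub-ren suc (exts τ) (σ i)) (sym (ren-sub τ suc (σ i)))

    subL-sub : ∀ {n m k} (σ : Fin n → Tm m) (τ : Fin m → Tm k) s →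
               subL τ (subL σ s) ≡ subL (sub τ ∘ σ) s
    subL-sub σ τ [ μ ∙ t ]   = cong [ μ ∙_] (sub-sub σ τ t)
    subL-sub σ τ (μ ∙ t ∨ s) = cong₂ (μ ∙_∨_) (sub-sub σ τ t) (subL-sub σ τ s)

    subR-sub : ∀ {n m k} (σ : Fin n → Tm m) (τ : Fin m → Tm k) s →
               subR τ (subR σ s) ≡ subR (sub τ ∘ σ) s
    subR-sub σ τ [ μ ∙ t ]   = cong [ μ ∙_] (sub-sub σ τ t)
    subR-sub σ τ (μ ∙ t ∨ s) = cong₂ (μ ∙_∨_) (sub-sub σ τ t) (subR-sub σ τ s)

  mutual
    sub-id : ∀ {n} {σ : Fin n → Tm n} → σ ≗ var → ∀ t → sub σ t ≡ t
    sub-id h 𝟏         = refl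
    sub-id h (sumL s)  = cong sumL (subL-id h s)
    sub-id h (sumR s)  = cong sumR (subR-id h s)
    sub-id h (out o t) = cong (out o) (sub-id h t)
    sub-id h (var i)   = h i
    sub-id h (rec t)   = cong rec (sub-id (λ { zero → refl ; (suc i) → cong (ren suc) (h i) }) t)

    subL-id : ∀ {n} {σ : Fin n → Tm n} → σ ≗ var → ∀ s → subL σ s ≡ s
    subL-id h [ μ ∙ t ]   = cong [ μ ∙_] (sub-id h t)
    subL-id h (μ ∙ t ∨ s) = cong₂ (μ ∙_∨_) (sub-id h t) (subL-id h s)

    subR-id : ∀ {n} {σ : Fin n → Tm n} → σ ≗ var → ∀ s → subR σ s ≡ s
    subR-id h [ μ ∙ t ]   = cong [ μ ∙_] (sub-id h t)
    subR-id h (μ ∙ t ∨ s) = cong₂ (μ ∙_∨_) (sub-id h t) (subR-id h s)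

  _▷_ : ∀ {n} → (Fin n → Tm 0) → Tm 0 → Fin (suc n) → Tm 0
  (σ ▷ u) zero    = u
  (σ ▷ u) (suc i) = σ i

  sub-closed : (σ : Fin 0 → Tm 0) (t : Tm 0) → sub σ t ≡ t
  sub-closed σ = sub-id (λ ())

  unfold-sub : ∀ {n} (σ : Fin n → Tm 0) (b : Tm (suc n)) →
               unfold (sub (exts σ) b) ≡ sub (σ ▷ rec (sub (exts σ) b)) b
  unfold-sub σ b = trans (sub-sub (exts σ) _ b) (sub-cong extended b)
    where
    extended : sub _ ∘ exts σ ≗ σ ▷ rec (sub (exts σ) b)
    extended zero    = refl
    extended (suc i) = trans (sub-ren suc _ (σ i)) (sub-closed _ (σ i))

-- A closed term reachable from f is
-- always an instance sub σ t of a non-variable subterm t of f; the list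
-- 'instances f' enumerates these instances, and their transitions stay
-- inside the list.  Indexing the list gives a finite graph bisimilar to f.

module OrchestratorGraph where
  open Substitution
  open import Data.List.Relation.Binary.Subset.Propositional using (_⊆_)

  mutual
    successors : ∀ {n} → Tm n → (Fin n → Tm 0) → List (Act × Tm 0)
    successors 𝟏         σ = []
    successors (sumL s)  σ = successorsL s σ
    successors (sumR s)  σ = successorsR s σ
    successors (out o t) σ = (embO o , sub σ t) ∷ []
    successors (var i)   σ = []
    successors (rec b)   σ = successors b (σ ▷ sub σ (rec b))

    successorsL : ∀ {n} → SumL n → (Fin n → Tm 0) → List (Act × Tm 0)
    successorsL [ ι ∙ t ]   σ = (embL ι , sub σ t) ∷ []
    successorsL (ι ∙ t ∨ s) σ = (embL ι , sub σ t) ∷ successorsL s σ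

    successorsR : ∀ {n} → SumR n → (Fin n → Tm 0) → List (Act × Tm 0)
    successorsR [ ι ∙ t ]   σ = (embR ι , sub σ t) ∷ []
    successorsR (ι ∙ t ∨ s) σ = (embR ι , sub σ t) ∷ successorsR s σ

  successorsL-sound : ∀ {n} (s : SumL n) σ {μ u} → (μ , u) ∈ successorsL s σ → StepL (subL σ s) μ u
  successorsL-sound [ ι ∙ t ]   σ (here refl) = single
  successorsL-sound (ι ∙ t ∨ s) σ (here refl) = here
  successorsL-sound (ι ∙ t ∨ s) σ (there m)   = there (successorsL-sound s σ m)

  successorsR-sound : ∀ {n} (s : SumR n) σ {μ u} → (μ , u) ∈ successorsR s σ → StepR (subR σ s) μ u
  successorsR-sound [ ι ∙ t ]   σ (here refl) = single
  successorsR-sound (ι ∙ t ∨ s) σ (here refl) = here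
  successorsR-sound (ι ∙ t ∨ s) σ (there m)   = there (successorsR-sound s σ m)

  successors-sound : ∀ {n} (t : Tm n) σ {μ u} → (μ , u) ∈ successors t σ → sub σ t —[ μ ]→ u
  successors-sound (sumL s)  σ m           = stL (successorsL-sound s σ m)
  successors-sound (sumR s)  σ m           = stR (successorsR-sound s σ m)
  successors-sound (out o t) σ (here refl) = stOut
  successors-sound (rec b)   σ m           =
    stRec (subst (_—[ _ ]→ _) (sym (unfold-sub σ b)) (successors-sound b _ m))

  successorsL-complete : ∀ {n} (s : SumL n) σ {μ u} → StepL (subL σ s) μ u → (μ , u) ∈ successorsL s σ
  successorsL-complete [ ι ∙ t ]   σ single    = here refl
  successorsL-complete (ι ∙ t ∨ s) σ here      = here refl
  successorsL-complete (ι ∙ t ∨ s) σ (there d) = there (successorsL-complete s σ d)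

  successorsR-complete : ∀ {n} (s : SumR n) σ {μ u} → StepR (subR σ s) μ u → (μ , u) ∈ successorsR s σ
  successorsR-complete [ ι ∙ t ]   σ single    = here refl
  successorsR-complete (ι ∙ t ∨ s) σ here      = here refl
  successorsR-complete (ι ∙ t ∨ s) σ (there d) = there (successorsR-complete s σ d)

  -- completeness needs t ≠ var (whose instance σ i has its own transitions);
  -- well-formedness propagates this to the bodies of rec
  successors-complete : ∀ {n} (t : Tm n) σ → WF t → NotVar t →
                        ∀ {μ u} → sub σ t —[ μ ]→ u → (μ , u) ∈ successors t σ
  successors-complete (sumL s)  σ _ _ (stL d) = successorsL-complete s σ d
  successors-complete (sumR s)  σ _ _ (stR d) = successorsR-complete s σ d
  successors-complete (out o t) σ _ _ stOut   = here refl
  successors-complete (rec b)   σ (wfRec nv w) _ (stRec d) =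
    successors-complete b _ w nv (subst (_—[ _ ]→ _) (unfold-sub σ b) d)

  record Instance : Set where
    constructor inst
    field
      {scope} : ℕ
      body    : Tm scope
      env     : Fin scope → Tm 0

  term : Instance → Tm 0
  term (inst t σ) = sub σ t

  mutual
    instances : ∀ {n} → Tm n → (Fin n → Tm 0) → List Instance
    instances 𝟏         σ = inst 𝟏 σ ∷ []
    instances (sumL s)  σ = inst (sumL s) σ ∷ instancesL s σ
    instances (sumR s)  σ = inst (sumR s) σ ∷ instancesR s σ
    instances (out o t) σ = inst (out o t) σ ∷ instances t σ
    instances (var i)   σ = []
    instances (rec b)   σ = inst (rec b) σ ∷ instances b (σ ▷ sub σ (rec b))

    instancesL : ∀ {n} → SumL n → (Fin n → Tm 0) → List Instance
    instancesL [ ι ∙ t ]   σ = instances t σ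
    instancesL (ι ∙ t ∨ s) σ = instances t σ ++ instancesL s σ

    instancesR : ∀ {n} → SumR n → (Fin n → Tm 0) → List Instance
    instancesR [ ι ∙ t ]   σ = instances t σ
    instancesR (ι ∙ t ∨ s) σ = instances t σ ++ instancesR s σ

  -- instances for which 'successors' is complete
  Good : Instance → Set
  Good (inst t σ) = WF t × NotVar t

  mutual
    instances-good : ∀ {n} {t : Tm n} σ → WF t → ∀ {i} → i ∈ instances t σ → Good i
    instances-good σ wf𝟏         (here refl) = wf𝟏 , nv𝟏
    instances-good σ (wfL w)      (here refl) = wfL w , nvL
    instances-good σ (wfL w)      (there m)   = instancesL-good σ w m
    instances-good σ (wfR w)      (here refl) = wfR w , nvR
    instances-good σ (wfR w)      (there m)   = instancesR-good σ w m
    instances-good σ (wfOut w)    (here refl) = wfOut w , nvOut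
    instances-good σ (wfOut w)    (there m)   = instances-good σ w m
    instances-good σ (wfRec nv w) (here refl) = wfRec nv w , nvRec
    instances-good σ (wfRec nv w) (there m)   = instances-good _ w m

    instancesL-good : ∀ {n} {s : SumL n} σ → WFL s → ∀ {i} → i ∈ instancesL s σ → Good i
    instancesL-good σ (wf[] w) m = instances-good σ w m
    instancesL-good {s = _ ∙ t ∨ s} σ (wf∨ w ws) m with AnyP.++⁻ (instances t σ) m
    ... | inj₁ m' = instances-good σ w m'
    ... | inj₂ m' = instancesL-good σ ws m'

    instancesR-good : ∀ {n} {s : SumR n} σ → WFR s → ∀ {i} → i ∈ instancesR s σ → Good i
    instancesR-good σ (wf[] w) m = instances-good σ w m
    instancesR-good {s = _ ∙ t ∨ s} σ (wf∨ w ws) m with AnyP.++⁻ (instances t σ) m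
    ... | inj₁ m' = instances-good σ w m'
    ... | inj₂ m' = instancesR-good σ ws m'

  self-instance : ∀ {n} {t : Tm n} σ → NotVar t → inst t σ ∈ instances t σ
  self-instance σ nv𝟏   = here refl
  self-instance σ nvL   = here refl
  self-instance σ nvR   = here refl
  self-instance σ nvOut = here refl
  self-instance σ nvRec = here refl

  module Closure (L : List Instance) where
    Covered : Tm 0 → Set
    Covered u = Any (λ i → term i ≡ u) L

    EnvCovered : ∀ {n} → (Fin n → Tm 0) → Set
    EnvCovered σ = ∀ i → Covered (σ i)

    member-covered : ∀ {i} → i ∈ L → Covered (term i)
    member-covered = Any.map (λ eq → cong term (sym eq))

    self-covered : ∀ {n} (t : Tm n) σ → EnvCovered σ → instances t σ ⊆ L → Covered (sub σ t)
    self-covered 𝟏         σ env sb = member-covered (sb (here refl))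
    self-covered (sumL s)  σ env sb = member-covered (sb (here refl))
    self-covered (sumR s)  σ env sb = member-covered (sb (here refl))
    self-covered (out o t) σ env sb = member-covered (sb (here refl))
    self-covered (var i)   σ env sb = env i
    self-covered (rec b)   σ env sb = member-covered (sb (here refl))

    summandsL-covered : ∀ {n} (s : SumL n) σ → EnvCovered σ → instancesL s σ ⊆ L →
                        ∀ {μ u} → (μ , u) ∈ successorsL s σ → Covered u
    summandsL-covered [ ι ∙ t ]   σ env sb (here refl) = self-covered t σ env sb
    summandsL-covered (ι ∙ t ∨ s) σ env sb (here refl) = self-covered t σ env (sb ∘ AnyP.++⁺ˡ)
    summandsL-covered (ι ∙ t ∨ s) σ env sb (there m)   =
      summandsL-covered s σ env (sb ∘ AnyP.++⁺ʳ (instances t σ)) m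

    summandsR-covered : ∀ {n} (s : SumR n) σ → EnvCovered σ → instancesR s σ ⊆ L →
                        ∀ {μ u} → (μ , u) ∈ successorsR s σ → Covered u
    summandsR-covered [ ι ∙ t ]   σ env sb (here refl) = self-covered t σ env sb
    summandsR-covered (ι ∙ t ∨ s) σ env sb (here refl) = self-covered t σ env (sb ∘ AnyP.++⁺ˡ)
    summandsR-covered (ι ∙ t ∨ s) σ env sb (there m)   =
      summandsR-covered s σ env (sb ∘ AnyP.++⁺ʳ (instances t σ)) m

    env-unfold : ∀ {n} (b : Tm (suc n)) σ → EnvCovered σ → instances (rec b) σ ⊆ L →
                 EnvCovered (σ ▷ sub σ (rec b))
    env-unfold b σ env sb zero    = member-covered (sb (here refl))
    env-unfold b σ env sb (suc i) = env i

    SuccessorsCovered : Instance → Set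
    SuccessorsCovered (inst t σ) = ∀ {μ u} → (μ , u) ∈ successors t σ → Covered u

    mutual
      successors-covered : ∀ {n} (t : Tm n) σ → WF t → EnvCovered σ → instances t σ ⊆ L →
                           ∀ {i} → i ∈ instances t σ → SuccessorsCovered i
      successors-covered (sumL s)  σ w          env sb (here refl) = summandsL-covered s σ env (sb ∘ there)
      successors-covered (sumL s)  σ (wfL w)    env sb (there k)   = successorsL-covered s σ w env (sb ∘ there) k
      successors-covered (sumR s)  σ w          env sb (here refl) = summandsR-covered s σ env (sb ∘ there)
      successors-covered (sumR s)  σ (wfR w)    env sb (there k)   = successorsR-covered s σ w env (sb ∘ there) k
      successors-covered (out o t) σ w          env sb (here refl) (here refl) = self-covered t σ env (sb ∘ there)
      successors-covered (out o t) σ (wfOut w)  env sb (there k)   = successors-covered t σ w env (sb ∘ there) k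
      successors-covered 𝟏         σ w          env sb (here refl) ()
      successors-covered (rec b) σ (wfRec nv w) env sb (here refl) =
        successors-covered b _ w (env-unfold b σ env sb) (sb ∘ there) (self-instance _ nv)
      successors-covered (rec b) σ (wfRec nv w) env sb (there k) =
        successors-covered b _ w (env-unfold b σ env sb) (sb ∘ there) k

      successorsL-covered : ∀ {n} (s : SumL n) σ → WFL s → EnvCovered σ → instancesL s σ ⊆ L →
                            ∀ {i} → i ∈ instancesL s σ → SuccessorsCovered i
      successorsL-covered [ ι ∙ t ] σ (wf[] w) env sb k = successors-covered t σ w env sb k
      successorsL-covered (ι ∙ t ∨ s) σ (wf∨ w ws) env sb k with AnyP.++⁻ (instances t σ) k
      ... | inj₁ k' = successors-covered t σ w env (sb ∘ AnyP.++⁺ˡ) k'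
      ... | inj₂ k' = successorsL-covered s σ ws env (sb ∘ AnyP.++⁺ʳ (instances t σ)) k'

      successorsR-covered : ∀ {n} (s : SumR n) σ → WFR s → EnvCovered σ → instancesR s σ ⊆ L →
                            ∀ {i} → i ∈ instancesR s σ → SuccessorsCovered i
      successorsR-covered [ ι ∙ t ] σ (wf[] w) env sb k = successors-covered t σ w env sb k
      successorsR-covered (ι ∙ t ∨ s) σ (wf∨ w ws) env sb k with AnyP.++⁻ (instances t σ) k
      ... | inj₁ k' = successors-covered t σ w env (sb ∘ AnyP.++⁺ˡ) k'
      ... | inj₂ k' = successorsR-covered s σ ws env (sb ∘ AnyP.++⁺ʳ (instances t σ)) k'

  -- The finite graph: nodes are positions in 'instances f', an edge
  -- (μ , k) ∈ edges j records the transition ⟦ j ⟧ —[ μ ]→ ⟦ k ⟧.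
  module FiniteGraph (f : Tm 0) (wf : WF f) where
    no-env : Fin 0 → Tm 0
    no-env ()

    nodeList : List Instance
    nodeList = instances f no-env
    open Closure nodeList

    size : ℕ
    size = length nodeList

    ⟦_⟧ : Fin size → Tm 0
    ⟦ j ⟧ = term (lookup nodeList j)

    successorsAt : Fin size → List (Act × Tm 0)
    successorsAt j = successors (Instance.body (lookup nodeList j)) (Instance.env (lookup nodeList j))

    covered : ∀ j → SuccessorsCovered (lookup nodeList j)
    covered j = successors-covered f no-env wf (λ ()) id (∈-lookup j)

    edges : Fin size → List (Act × Fin size)
    edges j = mapWith∈ (successorsAt j) (λ {(μ , _)} m → μ , Any.index (covered j m))

    edges-sound : ∀ {j μ k} → (μ , k) ∈ edges j → ⟦ j ⟧ —[ μ ]→ ⟦ k ⟧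
    edges-sound {j} e with AnyP.mapWith∈⁻ _ _ e
    ... | (μ , u) , m , refl =
      subst (⟦ j ⟧ —[ μ ]→_) (sym (AnyP.lookup-index (covered j m)))
            (successors-sound (Instance.body (lookup nodeList j)) (Instance.env (lookup nodeList j)) m)

    edges-complete : ∀ {j μ u} → ⟦ j ⟧ —[ μ ]→ u → Σ (Fin size) λ k → ((μ , k) ∈ edges j) × (u ≡ ⟦ k ⟧)
    edges-complete {j} d with instances-good no-env wf (∈-lookup j)
    ... | w , nv =
      let m = successors-complete (Instance.body (lookup nodeList j)) (Instance.env (lookup nodeList j)) w nv d
      in  Any.index (covered j m) , AnyP.mapWith∈⁺ _ (_ , m , refl) , sym (AnyP.lookup-index (covered j m))

    -- f itself is a node, since a closed term is not a variable
    closed-not-var : (g : Tm 0) → NotVar g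
    closed-not-var 𝟏         = nv𝟏
    closed-not-var (sumL _)  = nvL
    closed-not-var (sumR _)  = nvR
    closed-not-var (out _ _) = nvOut
    closed-not-var (rec _)   = nvRec

    root : Fin size
    root = Any.index (self-instance no-env (closed-not-var f))

    root-term : ⟦ root ⟧ ≡ f
    root-term = trans (cong term (sym (AnyP.lookup-index (self-instance no-env (closed-not-var f)))))
                      (sub-closed no-env f)

module Pigeonhole where

  Distinct : ∀ {N} → List (Fin N) → Set
  Distinct []       = ⊤
  Distinct (x ∷ xs) = x ∉ xs × Distinct xs

  distinct-injective : ∀ {N} (xs : List (Fin N)) → Distinct xs →
                       ∀ i j → i F.< j → lookup xs i ≡ lookup xs j → ⊥
  distinct-injective (x ∷ xs) (x∉ , d) zero (suc j) _ eq = x∉ (subst (_∈ xs) (sym eq) (∈-lookup j))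
  distinct-injective (x ∷ xs) (x∉ , d) (suc i) (suc j) (s≤s i<j) eq = distinct-injective xs d i j i<j eq

  distinct-length : ∀ {N} (xs : List (Fin N)) → Distinct xs → length xs ≤ N
  distinct-length {N} xs d with length xs ℕ.≤? N
  ... | yes ok = ok
  ... | no long with FP.pigeonhole (ℕP.≰⇒> long) (lookup xs)
  ...   | i , j , i<j , eq = ⊥-elim (distinct-injective xs d i j i<j eq)

  -- A constructive pigeonhole principle for infinite sequences: if Q is not
  -- eventually false, a sequence in Fin N takes the same value at two
  -- Q-positions beyond any k.  (It is stated as a refutation of injectivity on
  -- those positions, which is what the ¬¬-hypothesis supports.)

  recurrent-repeat : ∀ {N} (node : ℕ → Fin N) (Q : ℕ → Set) k →
                     ¬ (∃ λ k' → ∀ m → k' ≤ m → ¬ Q m) →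
                     ¬ (∀ m₁ m₂ → k ≤ m₁ → m₁ < m₂ → Q m₁ → node m₁ ≡ node m₂ → ⊥)
  recurrent-repeat {N} node Q k recurrent injective =
    collect (suc N) [] k tt (ℕP.≤-reflexive (sym (ℕP.+-identityʳ (suc N)))) ℕP.≤-refl (λ ())
    where
    Seen : List (Fin N) → ℕ → Set
    Seen U k' = ∀ {u} → u ∈ U → Σ ℕ λ m → k ≤ m × m < k' × Q m × node m ≡ u

    -- collecting n more distinct values would exceed N
    collect : ∀ n U k' → Distinct U → suc N ≤ n ℕ.+ length U → k ≤ k' → Seen U k' → ⊥
    collect zero U k' d big _ _ = ℕP.<-irrefl refl (ℕP.<-≤-trans big (distinct-length U d))
    collect (suc n) U k' d big k≤k' seen = recurrent (k' , λ m k'≤m qm →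
      collect n (node m ∷ U) (suc m) (new m k'≤m , d)
              (ℕP.≤-trans big (ℕP.≤-reflexive (sym (ℕP.+-suc n (length U)))))
              (ℕP.≤-trans k≤k' (ℕP.≤-trans k'≤m (ℕP.n≤1+n m)))
              (seen-more m k'≤m qm))
      where
      new : ∀ m → k' ≤ m → node m ∉ U
      new m k'≤m u∈U with seen u∈U
      ... | m₀ , k≤m₀ , m₀<k' , qm₀ , eq = injective m₀ m k≤m₀ (ℕP.<-≤-trans m₀<k' k'≤m) qm₀ eq
      seen-more : ∀ m → k' ≤ m → Q m → Seen (node m ∷ U) (suc m)
      seen-more m k'≤m qm (here refl) = m , ℕP.≤-trans k≤k' k'≤m , ℕP.≤-refl , qm , refl
      seen-more m k'≤m qm (there u∈U) with seen u∈U
      ... | m₀ , k≤m₀ , m₀<k' , qm₀ , eq =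
        m₀ , k≤m₀ , ℕP.<-≤-trans m₀<k' (ℕP.≤-trans k'≤m (ℕP.n≤1+n m)) , qm₀ , eq

-- Any path of length ≥ N repeats a node and thus contains a loop; cutting
-- loops out gives short paths, so reachability questions reduce to a
-- bounded search, which is decidable.

module Paths (N : ℕ) (E : Fin N → List (Act × Fin N)) where
  open Pigeonhole
  open import Data.List.Membership.DecPropositional (FP._≟_ {N}) using (_∈?_)

  data Path : Fin N → List Act → Fin N → Set where
    done : ∀ {x} → Path x [] x
    step : ∀ {x μ y s z} → (μ , y) ∈ E x → Path y s z → Path x (μ ∷ s) z

  _++ᴾ_ : ∀ {x s y t z} → Path x s y → Path y t z → Path x (s ++ t) z
  done     ++ᴾ q = q
  step e p ++ᴾ q = step e (p ++ᴾ q)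

  split-path : ∀ {x y} s {t} → Path x (s ++ t) y → Σ (Fin N) λ z → Path x s z × Path z t y
  split-path []      p          = _ , done , p
  split-path (μ ∷ s) (step e p) with split-path s p
  ... | z , p₁ , p₂ = z , step e p₁ , p₂

  take-path : ∀ {x s y} → Path x s y → ∀ n → Σ (Fin N) λ z → Path x (take n s) z
  take-path p          zero    = _ , done
  take-path done       (suc n) = _ , done
  take-path (step e p) (suc n) = _ , step e (proj₂ (take-path p n))

  rotate : ∀ {x} c₁ {c₂} → Path x (c₁ ++ c₂) x → Σ (Fin N) λ z → Path x c₁ z × Path z (c₂ ++ c₁) z
  rotate c₁ q with split-path c₁ q
  ... | z , q₁ , q₂ = z , q₁ , q₂ ++ᴾ q₁

  nodes : ∀ {x s y} → Path x s y → List (Fin N)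
  nodes {x} done       = x ∷ []
  nodes {x} (step _ p) = x ∷ nodes p

  nodes-length : ∀ {x s y} (p : Path x s y) → length (nodes p) ≡ suc (length s)
  nodes-length done       = refl
  nodes-length (step _ p) = cong suc (nodes-length p)

  record Loop (x : Fin N) (s : List Act) (z : Fin N) : Set where
    field
      y          : Fin N
      s₁ s₂ s₃   : List Act
      decomposed : s ≡ s₁ ++ (s₂ ++ s₃)
      non-empty  : 1 ≤ length s₂
      before     : Path x s₁ y
      loop       : Path y s₂ y
      after      : Path y s₃ z

  split-at-node : ∀ {x y s z} (p : Path y s z) → x ∈ nodes p →
                  Σ (List Act) λ t → Σ (List Act) λ u → (s ≡ t ++ u) × Path y t x × Path x u z
  split-at-node done       (here refl) = [] , [] , refl , done , done
  split-at-node (step e p) (here refl) = [] , _ , refl , done , step e p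
  split-at-node (step {μ = μ} e p) (there m) with split-at-node p m
  ... | t , u , eq , q₁ , q₂ = μ ∷ t , u , cong (μ ∷_) eq , step e q₁ , q₂

  loop-or-distinct : ∀ {x s z} (p : Path x s z) → Loop x s z ⊎ Distinct (nodes p)
  loop-or-distinct done = inj₂ ((λ ()) , tt)
  loop-or-distinct {x} (step {μ = μ} e p) with loop-or-distinct p
  ... | inj₁ ℓ = inj₁ (record { Loop ℓ ; s₁ = μ ∷ Loop.s₁ ℓ ; decomposed = cong (μ ∷_) (Loop.decomposed ℓ)
                              ; before = step e (Loop.before ℓ) })
  ... | inj₂ d with x ∈? nodes p
  ...   | no x∉ = inj₂ (x∉ , d)
  ...   | yes m with split-at-node p m
  ...     | t , u , eq , q₁ , q₂ =
    inj₁ (record { y = x ; s₁ = [] ; s₂ = μ ∷ t ; s₃ = u ; decomposed = cong (μ ∷_) eq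
                 ; non-empty = s≤s z≤n ; before = done ; loop = step e q₁ ; after = q₂ })

  -- a path with at least N steps visits N + 1 nodes, so one of them twice
  long-path-loop : ∀ {x s z} (p : Path x s z) → N ≤ length s → Loop x s z
  long-path-loop p N≤ with loop-or-distinct p
  ... | inj₁ ℓ = ℓ
  ... | inj₂ d = ⊥-elim (ℕP.<-irrefl refl (ℕP.≤-trans (s≤s N≤)
                   (subst (_≤ N) (nodes-length p) (distinct-length (nodes p) d))))

  module _ {x s z} (ℓ : Loop x s z) where
    open Loop ℓ

    loop-length : length s ≡ length s₁ ℕ.+ (length s₂ ℕ.+ length s₃)
    loop-length rewrite decomposed | LP.length-++ s₁ {s₂ ++ s₃} | LP.length-++ s₂ {s₃} = refl

    loop-length≤ : length s₂ ≤ length s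
    loop-length≤ rewrite loop-length =
      ℕP.≤-trans (ℕP.m≤m+n (length s₂) (length s₃)) (ℕP.m≤n+m _ (length s₁))

    cut : Path x (s₁ ++ s₃) z
    cut = before ++ᴾ after

    cut-length< : length (s₁ ++ s₃) < length s
    cut-length< rewrite loop-length | LP.length-++ s₁ {s₃} =
      ℕP.+-monoʳ-< (length s₁) (ℕP.m<n+m (length s₃) non-empty)

  -- every path can be shortened to one with fewer than N steps
  -- (by cutting loops; the extra argument bounds the number of cuts)
  shorten : ∀ {x s z} → Path x s z → Σ (List Act) λ s' → Path x s' z × length s' < N
  shorten {s = s} = go (length s) ℕP.≤-refl
    where
    go : ∀ n {x s z} → length s ≤ n → Path x s z → Σ (List Act) λ s' → Path x s' z × length s' < N
    go n {s = s} le p with length s ℕ.<? N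
    ... | yes short = s , p , short
    ... | no long with long-path-loop p (ℕP.≮⇒≥ long)
    go zero    le p | no _ | ℓ = ⊥-elim (ℕP.n≮0 (ℕP.<-≤-trans (cut-length< ℓ) le))
    go (suc n) le p | no _ | ℓ = go n (ℕP.≤-pred (ℕP.<-≤-trans (cut-length< ℓ) le)) (cut ℓ)

  Bounded : Fin N → ℕ → (List Act → Fin N → Set) → Set
  Bounded x L P = Σ (List Act) λ s → Σ (Fin N) λ y → Path x s y × length s ≤ L × P s y

  bounded? : ∀ L x {P : List Act → Fin N → Set} → (∀ s y → Dec (P s y)) → Dec (Bounded x L P)
  bounded? L x P? with P? [] x
  ... | yes p = yes ([] , x , done , z≤n , p)
  bounded? zero x P? | no ¬p = no λ { (_ , _ , done , _ , p) → ¬p p ; (_ , _ , step _ _ , () , _) }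
  bounded? (suc L) x {P} P? | no ¬p
    with Any.any? (λ (μ , y) → bounded? L y (λ s z → P? (μ ∷ s) z)) (E x)
  ... | yes later with find later
  ...   | _ , m , (s , z , p , le , ps) = yes (_ , z , step m p , s≤s le , ps)
  bounded? (suc L) x {P} P? | no ¬p | no ¬later =
    no λ { (_ , _ , done , _ , p) → ¬p p
         ; (_ , _ , step m p , s≤s le , ps) → ¬later (lose m (_ , _ , p , le , ps)) }

  PathTo : Fin N → (Fin N → Set) → Set
  PathTo x T = Σ (List Act) λ s → Σ (Fin N) λ y → Path x s y × T y

  path-to? : ∀ x {T : Fin N → Set} → (∀ y → Dec (T y)) → Dec (PathTo x T)
  path-to? x T? with bounded? N x (λ _ y → T? y)
  ... | yes (s , y , p , _ , t) = yes (s , y , p , t)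
  ... | no ¬b = no λ { (s , y , p , t) → let (s' , p' , short) = shorten p
                                          in ¬b (s' , y , p' , ℕP.<⇒≤ short , t) }

balance : (Act → ℤ) → List Act → ℤ
balance w = foldr (λ μ z → w μ ℤ.+ z) (+ 0)

balance-++ : ∀ w s t → balance w (s ++ t) ≡ balance w s ℤ.+ balance w t
balance-++ w []      t = sym (ℤP.+-identityˡ _)
balance-++ w (μ ∷ s) t = trans (cong (λ z → w μ ℤ.+ z) (balance-++ w s t)) (sym (ℤP.+-assoc (w μ) _ _))

remove-nonnegative : ∀ w s₁ s₂ s₃ → + 0 ℤ.≤ balance w s₂ →
                     balance w (s₁ ++ s₃) ℤ.≤ balance w (s₁ ++ (s₂ ++ s₃))
remove-nonnegative w s₁ s₂ s₃ 0≤s₂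
  rewrite balance-++ w s₁ s₃ | balance-++ w s₁ (s₂ ++ s₃) | balance-++ w s₂ s₃ =
  ℤP.+-monoʳ-≤ (balance w s₁)
    (subst (ℤ._≤ balance w s₂ ℤ.+ balance w s₃) (ℤP.+-identityˡ _) (ℤP.+-monoˡ-≤ (balance w s₃) 0≤s₂))

module Balances (N : ℕ) (E : Fin N → List (Act × Fin N)) (st : Fin N) where
  open Paths N E public
  open import Algebra.Properties.AbelianGroup ℤP.+-0-abelianGroup using (∙-cancelʳ)

  ReachableCycle : (List Act → Set) → Set
  ReachableCycle P = Bounded st N (λ _ y → Bounded y N (λ c y' → y' ≡ y × P c))

  reachable-cycle? : ∀ {P} → (∀ c → Dec (P c)) → Dec (ReachableCycle P)
  reachable-cycle? P? = bounded? N st (λ _ y → bounded? N y (λ c y' → (y' FP.≟ y) ×-dec P? c))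

  SplitStable : (List Act → Set) → Set
  SplitStable P = ∀ μ s₁ s₂ s₃ → P (μ ∷ (s₁ ++ (s₂ ++ s₃))) → P s₂ ⊎ P (μ ∷ (s₁ ++ s₃))

  short-cycle : ∀ {P} → SplitStable P → ∀ {s x c} → Path st s x → Path x c x → P c → ReachableCycle P
  short-cycle {P} split {c = c} = go (length c) ℕP.≤-refl
    where
    go : ∀ n {s x c} → length c ≤ n → Path st s x → Path x c x → P c → ReachableCycle P
    go n {c = c} le p q pc with length c ℕ.≤? N
    ... | yes short with shorten p
    ...   | s' , p' , short' = s' , _ , p' , ℕP.<⇒≤ short' , c , _ , q , short , refl , pc
    go n       {c = []}    le       p q          pc | no long = ⊥-elim (long z≤n)
    go (suc n) {c = μ ∷ c} (s≤s le) p (step e q) pc | no long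
      with long-path-loop q (ℕP.≤-pred (ℕP.≰⇒> long))
    ... | ℓ with split μ (Loop.s₁ ℓ) (Loop.s₂ ℓ) (Loop.s₃ ℓ)
                   (subst (λ z → P (μ ∷ z)) (Loop.decomposed ℓ) pc)
    ...   | inj₁ inner = go n (ℕP.≤-trans (loop-length≤ ℓ) le) (p ++ᴾ step e (Loop.before ℓ)) (Loop.loop ℓ) inner
    ...   | inj₂ outer = go n (ℕP.≤-trans (cut-length< ℓ) le) p (step e (cut ℓ)) outer

  Negative : (Act → ℤ) → List Act → Set
  Negative w s = balance w s ℤ.< + 0

  NonNegative : (Act → ℤ) → Set
  NonNegative w = ∀ {s y} → Path st s y → + 0 ℤ.≤ balance w s

  split-negative : ∀ w → SplitStable (Negative w)
  split-negative w μ s₁ s₂ s₃ neg with balance w s₂ ℤP.<? + 0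
  ... | yes inner = inj₁ inner
  ... | no ¬inner =
    inj₂ (ℤP.≤-<-trans (ℤP.+-monoʳ-≤ (w μ) (remove-nonnegative w s₁ s₂ s₃ (ℤP.≮⇒≥ ¬inner))) neg)

  NegativeWitness : (Act → ℤ) → Set
  NegativeWitness w = Bounded st N (λ s _ → Negative w s) ⊎ ReachableCycle (Negative w)

  negative-witness : ∀ w {s y} → Path st s y → Negative w s → NegativeWitness w
  negative-witness w {s} = go (length s) ℕP.≤-refl
    where
    go : ∀ n {s y} → length s ≤ n → Path st s y → Negative w s → NegativeWitness w
    go n {s} le p neg with length s ℕ.≤? N
    ... | yes short = inj₁ (s , _ , p , short , neg)
    ... | no long with long-path-loop p (ℕP.<⇒≤ (ℕP.≰⇒> long))
    ... | ℓ with balance w (Loop.s₂ ℓ) ℤP.<? + 0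
    ...   | yes inner = inj₂ (short-cycle (split-negative w) (Loop.before ℓ) (Loop.loop ℓ) inner)
    go zero    le p neg | no _ | ℓ | no _ = ⊥-elim (ℕP.n≮0 (ℕP.<-≤-trans (cut-length< ℓ) le))
    go (suc n) {s} le p neg | no _ | ℓ | no ¬inner =
      go n (ℕP.≤-pred (ℕP.<-≤-trans (cut-length< ℓ) le)) (cut ℓ) (ℤP.≤-<-trans lower neg)
      where
      open Loop ℓ
      lower : balance w (s₁ ++ s₃) ℤ.≤ balance w s
      lower = subst (λ z → balance w (s₁ ++ s₃) ℤ.≤ balance w z) (sym decomposed)
                    (remove-nonnegative w s₁ s₂ s₃ (ℤP.≮⇒≥ ¬inner))

  pump : ∀ w {x c} → Path x c x → Negative w c →
         ∀ n {s} → Path st s x → balance w s ℤ.< + n → Σ (List Act) λ s' → Path st s' x × Negative w s'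
  pump w q neg zero    p below = _ , p , below
  pump w {c = c} q neg (suc n) {s} p below = pump w q neg n (p ++ᴾ q) lowered
    where
    lowered : balance w (s ++ c) ℤ.< + n
    lowered rewrite balance-++ w s c =
      subst (balance w s ℤ.+ balance w c ℤ.<_) (ℤP.+-identityʳ (+ n))
            (ℤP.+-mono-≤-< (ℤP.i<j⇒i≤pred[j] below) neg)

  witness-negative : ∀ w → NegativeWitness w → Σ (List Act) λ s → Σ (Fin N) λ y → Path st s y × Negative w s
  witness-negative w (inj₁ (s , y , p , _ , neg)) = s , y , p , neg
  witness-negative w (inj₂ (s , x , p , _ , c , .x , q , _ , refl , neg)) =
    let (s' , p' , neg') = pump w q neg (suc ℤ.∣ balance w s ∣) p
                                (ℤP.≤-<-trans (below-abs (balance w s)) (ℤ.+<+ (ℕP.n<1+n _)))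
    in  s' , x , p' , neg'
    where
    below-abs : ∀ i → i ℤ.≤ + ℤ.∣ i ∣
    below-abs (+ n)    = ℤP.≤-refl
    below-abs -[1+ n ] = ℤ.-≤+

  nonNegative? : ∀ w → Dec (NonNegative w)
  nonNegative? w with bounded? N st (λ s _ → balance w s ℤP.<? + 0) ⊎-dec reachable-cycle? (λ c → balance w c ℤP.<? + 0)
  ... | yes wit = no λ nonneg → let (s , y , p , neg) = witness-negative w wit in ℤP.<⇒≱ neg (nonneg p)
  ... | no ¬wit = yes λ p → ℤP.≮⇒≥ λ neg → ¬wit (negative-witness w p neg)

  -- It is
  -- decided through a potential φ: the balance of one fixed path from st to
  -- each reachable node.  Zero balances into T hold iff φ is consistent on
  -- edges between reachable nodes from which T is reachable, vanishes on
  -- reachable targets, and vanishes at st when T is reachable at all.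

  ZeroInto : (Fin N → Set) → (Act → ℤ) → Set
  ZeroInto T w = ∀ {s y} → Path st s y → T y → balance w s ≡ + 0

  Reachable : Fin N → Set
  Reachable x = Σ (List Act) λ s → Path st s x

  reachable? : ∀ x → Dec (Reachable x)
  reachable? x with path-to? st (FP._≟ x)
  ... | yes (s , y , p , refl) = yes (s , p)
  ... | no ¬r = no λ { (s , p) → ¬r (s , x , p , refl) }

  module Potential (w : Act → ℤ) {T : Fin N → Set} (T? : ∀ y → Dec (T y)) where
    potential : ∀ x → Dec (Reachable x) → ℤ
    potential x (yes (s , _)) = balance w s
    potential x (no _)        = + 0

    φ : Fin N → ℤ
    φ x = potential x (reachable? x)

    φ-path : ∀ {s x} → Path st s x → Σ (List Act) λ s' → Path st s' x × balance w s' ≡ φ x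
    φ-path {x = x} p with reachable? x
    ... | yes (s' , p') = s' , p' , refl
    ... | no ¬r = ⊥-elim (¬r (_ , p))

    Consistent : Set
    Consistent = ∀ x → Reachable x →
                 All (λ (μ , y) → PathTo y T → φ x ℤ.+ w μ ≡ φ y) (E x)

    ZeroAtTargets : Set
    ZeroAtTargets = ∀ x → Reachable x → T x → φ x ≡ + 0

    ZeroAtStart : Set
    ZeroAtStart = PathTo st T → φ st ≡ + 0

    potential-conditions? : Dec (Consistent × ZeroAtTargets × ZeroAtStart)
    potential-conditions? =
      FP.all? (λ x → reachable? x →-dec All.all? (λ (μ , y) → path-to? y T? →-dec (_ ℤP.≟ _)) (E x))
      ×-dec FP.all? (λ x → reachable? x →-dec (T? x →-dec (_ ℤP.≟ _)))
      ×-dec (path-to? st T? →-dec (_ ℤP.≟ _))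

    -- the three conditions are necessary ...
    zero⇒conditions : ZeroInto T w → Consistent × ZeroAtTargets × ZeroAtStart
    zero⇒conditions zeros = consistent , at-targets , at-start
      where
      at-start : ZeroAtStart
      at-start (s , t , r , Tt) with φ-path (done {st})
      ... | s' , p' , eq = begin
        φ st                          ≡⟨ sym eq ⟩
        balance w s'                  ≡⟨ sym (ℤP.+-identityʳ _) ⟩
        balance w s' ℤ.+ + 0          ≡⟨ cong (λ z → balance w s' ℤ.+ z) (sym (zeros r Tt)) ⟩
        balance w s' ℤ.+ balance w s  ≡⟨ sym (balance-++ w s' s) ⟩
        balance w (s' ++ s)           ≡⟨ zeros (p' ++ᴾ r) Tt ⟩
        + 0                           ∎
        where open ≡-Reasoning
      at-targets : ZeroAtTargets
      at-targets x (s , p) Tx with φ-path p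
      ... | s' , p' , eq = trans (sym eq) (zeros p' Tx)
      consistent : Consistent
      consistent x (s , p) = All.tabulate edge
        where
        edge : ∀ {μy : Act × Fin N} → μy ∈ E x → PathTo (proj₂ μy) T → φ x ℤ.+ w (proj₁ μy) ≡ φ (proj₂ μy)
        edge {μ , y} e (t , u , r , Tu) with φ-path p | φ-path (p ++ᴾ step e done)
        ... | s₁ , p₁ , eq₁ | s₂ , p₂ , eq₂ = ∙-cancelʳ (balance w t) _ _ (begin
          φ x ℤ.+ w μ ℤ.+ balance w t           ≡⟨ ℤP.+-assoc (φ x) (w μ) (balance w t) ⟩
          φ x ℤ.+ balance w (μ ∷ t)             ≡⟨ cong (ℤ._+ balance w (μ ∷ t)) (sym eq₁) ⟩
          balance w s₁ ℤ.+ balance w (μ ∷ t)    ≡⟨ sym (balance-++ w s₁ (μ ∷ t)) ⟩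
          balance w (s₁ ++ μ ∷ t)               ≡⟨ zeros (p₁ ++ᴾ step e r) Tu ⟩
          + 0                                   ≡⟨ sym (zeros (p₂ ++ᴾ r) Tu) ⟩
          balance w (s₂ ++ t)                   ≡⟨ balance-++ w s₂ t ⟩
          balance w s₂ ℤ.+ balance w t          ≡⟨ cong (ℤ._+ balance w t) eq₂ ⟩
          φ y ℤ.+ balance w t                   ∎)
          where open ≡-Reasoning

    -- ... and sufficient: along a path into T, consistency keeps the
    -- balance equal to the potential of the current node
    follow : Consistent → ∀ {z t y} → Path z t y → T y →
             ∀ {s} → Path st s z → balance w s ≡ φ z → balance w (s ++ t) ≡ φ y
    follow cons done Ty {s} pz eq = trans (cong (balance w) (LP.++-identityʳ s)) eq
    follow cons {z} (step {μ = μ} {s = t} e r) Ty {s} pz eq =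
      trans (cong (balance w) (sym (LP.++-assoc s (μ ∷ []) t)))
            (follow cons r Ty (pz ++ᴾ step e done) (begin
              balance w (s ++ μ ∷ [])             ≡⟨ balance-++ w s (μ ∷ []) ⟩
              balance w s ℤ.+ (w μ ℤ.+ + 0)       ≡⟨ cong₂ ℤ._+_ eq (ℤP.+-identityʳ (w μ)) ⟩
              φ z ℤ.+ w μ                         ≡⟨ All.lookup (cons z (s , pz)) e (_ , _ , r , Ty) ⟩
              φ _                                 ∎))
      where open ≡-Reasoning

    conditions⇒zero : Consistent × ZeroAtTargets × ZeroAtStart → ZeroInto T w
    conditions⇒zero (cons , at-targets , at-start) {s} {y} p Ty =
      trans (follow cons p Ty done (sym (at-start (s , y , p , Ty)))) (at-targets y (s , p) Ty)

  zeroInto? : ∀ {T} → (∀ y → Dec (T y)) → ∀ w → Dec (ZeroInto T w)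
  zeroInto? T? w with Potential.potential-conditions? w T?
  ... | yes c  = yes (Potential.conditions⇒zero w T? c)
  ... | no ¬c = no λ z → ¬c (Potential.zero⇒conditions w T? z)

segment : (ℕ → Act) → ℕ → ℕ → List Act
segment g k zero    = []
segment g k (suc d) = g k ∷ segment g (suc k) d

segment-length : ∀ g k d → length (segment g k d) ≡ d
segment-length g k zero    = refl
segment-length g k (suc d) = cong suc (segment-length g (suc k) d)

prefix-segment : ∀ g n → prefix g n ≡ segment g 0 n
prefix-segment g n = shifted 0 n
  where
  applyUpTo-cong : ∀ {f h : ℕ → Act} → f ≗ h → ∀ n → applyUpTo f n ≡ applyUpTo h n
  applyUpTo-cong eq zero    = refl
  applyUpTo-cong eq (suc n) = cong₂ _∷_ (eq 0) (applyUpTo-cong (eq ∘ suc) n)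
  shifted : ∀ k n → applyUpTo (λ i → g (k ℕ.+ i)) n ≡ segment g k n
  shifted k zero    = refl
  shifted k (suc n) = cong₂ _∷_ (cong g (ℕP.+-identityʳ k))
    (trans (applyUpTo-cong (λ i → cong g (ℕP.+-suc k i)) n) (shifted (suc k) n))

segment-head : ∀ g k d → 1 ≤ d → g k ∈ segment g k d
segment-head g k (suc d) _ = here refl

segment-all : ∀ {P : Act → Set} g k → (∀ m → k ≤ m → P (g m)) → ∀ d → All P (segment g k d)
segment-all g k late zero    = []
segment-all g k late (suc d) = late k ℕP.≤-refl ∷ segment-all g (suc k) (λ m le → late m (ℕP.<⇒≤ le)) d

module Runs (N : ℕ) (E : Fin N → List (Act × Fin N)) (st : Fin N) where
  open Balances N E st public

  record Run (x : Fin N) : Set where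
    field
      node : ℕ → Fin N
      act  : ℕ → Act
      starts : node 0 ≡ x
      moves  : ∀ i → (act i , node (suc i)) ∈ E (node i)

  module _ {x} (r : Run x) where
    open Run r

    segment-path : ∀ k d → Path (node k) (segment act k d) (node (k ℕ.+ d))
    segment-path k zero    = subst (λ z → Path (node k) [] (node z)) (sym (ℕP.+-identityʳ k)) done
    segment-path k (suc d) = subst (λ z → Path (node k) (segment act k (suc d)) (node z)) (sym (ℕP.+-suc k d))
                                   (step (moves k) (segment-path (suc k) d))

    prefix-path : ∀ k → Path x (prefix act k) (node k)
    prefix-path k = subst₂ (λ z l → Path z l (node k)) starts (sym (prefix-segment act k)) (segment-path 0 k)

    repeat-cycle : ∀ {m₁ m₂} → m₁ < m₂ → node m₁ ≡ node m₂ →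
                   Path (node m₁) (segment act m₁ (m₂ ℕ.∸ m₁)) (node m₁)
    repeat-cycle {m₁} {m₂} m₁<m₂ eq =
      subst (Path (node m₁) _) (trans (cong node (ℕP.m+[n∸m]≡n (ℕP.<⇒≤ m₁<m₂))) (sym eq))
            (segment-path m₁ (m₂ ℕ.∸ m₁))

    -- among the N + 1 positions after k two carry the same node: the run
    -- continues from k by a path of length i and then a cycle of length d
    record Window (k : ℕ) : Set where
      field
        i d     : ℕ
        cycle-non-empty : 1 ≤ d
        within  : i ℕ.+ d ≤ N
        stem    : Path (node k) (segment act k i) (node (k ℕ.+ i))
        cycle   : Path (node (k ℕ.+ i)) (segment act (k ℕ.+ i) d) (node (k ℕ.+ i))

    window : ∀ k → Window k
    window k with FP.pigeonhole (ℕP.n<1+n N) (λ (i : Fin (suc N)) → node (k ℕ.+ toℕ i))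
    ... | i , j , i<j , eq = record
      { i = toℕ i ; d = toℕ j ℕ.∸ toℕ i
      ; cycle-non-empty = ℕP.m<n⇒0<n∸m i<j
      ; within = subst (_≤ N) (sym (ℕP.m+[n∸m]≡n (ℕP.<⇒≤ i<j))) (ℕP.≤-pred (FP.toℕ<n j))
      ; stem = segment-path k (toℕ i)
      ; cycle = subst (Path (node (k ℕ.+ toℕ i)) _) (trans (cong node e) (sym eq))
                      (segment-path (k ℕ.+ toℕ i) (toℕ j ℕ.∸ toℕ i)) }
      where
      e : k ℕ.+ toℕ i ℕ.+ (toℕ j ℕ.∸ toℕ i) ≡ k ℕ.+ toℕ j
      e = trans (ℕP.+-assoc k (toℕ i) _) (cong (k ℕ.+_) (ℕP.m+[n∸m]≡n (ℕP.<⇒≤ i<j)))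

  prepend : ∀ {y s x} → Path y s x → Run x → Run y
  prepend done r = r
  prepend {y} (step {μ = μ} e p) r = record
    { node   = λ { zero → y ; (suc n) → Run.node r' n }
    ; act    = λ { zero → μ ; (suc n) → Run.act r' n }
    ; starts = refl
    ; moves  = λ { zero → subst (λ z → (μ , z) ∈ E y) (sym (Run.starts r')) e ; (suc n) → Run.moves r' n } }
    where r' = prepend p r

  module _ {y s x} (p : Path y s x) (r : Run x) where
    private
      act : ℕ → Act
      act = Run.act (prepend p r)

    prepend-prefix : prefix act (length s) ≡ s
    prepend-prefix = go p
      where
      go : ∀ {y s} (p : Path y s x) → prefix (Run.act (prepend p r)) (length s) ≡ s
      go done               = refl
      go (step {μ = μ} e q) = cong (μ ∷_) (go q)

    prepend-shift : ∀ m → act (length s ℕ.+ m) ≡ Run.act r m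
    prepend-shift = go p
      where
      go : ∀ {y s} (p : Path y s x) m → Run.act (prepend p r) (length s ℕ.+ m) ≡ Run.act r m
      go done       m = refl
      go (step e q) m = go q m

    prepend-tail : ∀ {P : Act → Set} → (∀ m → P (Run.act r m)) → ∀ m → length s ≤ m → P (act m)
    prepend-tail {P} all m le =
      subst (P ∘ act) (ℕP.m+[n∸m]≡n le) (subst P (sym (prepend-shift (m ℕ.∸ length s))) (all _))

    prepend-often : ∀ {P : Act → Set} → (∀ k → Σ ℕ λ m → k ≤ m × P (Run.act r m)) →
                    ∀ k → Σ ℕ λ m → k ≤ m × P (act m)
    prepend-often {P} often k with often k
    ... | m , le , pm = length s ℕ.+ m , ℕP.≤-trans le (ℕP.m≤n+m m (length s)) , subst P (sym (prepend-shift m)) pm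

  prepend-all : ∀ {y s x} (p : Path y s x) (r : Run x) {P : Act → Set} → All P s →
                (∀ m → P (Run.act r m)) → ∀ m → P (Run.act (prepend p r) m)
  prepend-all done       r []         all m       = all m
  prepend-all (step e p) r (ps ∷ pss) all zero    = ps
  prepend-all (step e p) r (ps ∷ pss) all (suc m) = prepend-all p r pss all m

  -- Going around a non-empty cycle μ ∷ c forever.  A position records the
  -- remaining part of the current round, a suffix of μ ∷ c.
  module Cycling {x μ c} (cycle : Path x (μ ∷ c) x) where
    record Position : Set where
      constructor position
      field
        {here-node} : Fin N
        next        : Act
        rest        : List Act
        remaining   : Path here-node (next ∷ rest) x
        {passed}    : List Act
        round       : passed ++ (next ∷ rest) ≡ μ ∷ c

    begin-round : Position
    begin-round = position μ c cycle {[]} refl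

    advance : Position → Position
    advance (position ν []         (step e done) _)   = begin-round
    advance (position ν (ν' ∷ c'') (step e q) {pre} eq) =
      position ν' c'' q (trans (LP.++-assoc pre (ν ∷ []) (ν' ∷ c'')) eq)

    advance-edge : ∀ k → (Position.next k , Position.here-node (advance k)) ∈ E (Position.here-node k)
    advance-edge (position ν []         (step e done) _) = e
    advance-edge (position ν (ν' ∷ c'') (step e q)    _) = e

    iterate : ℕ → Position → Position
    iterate zero    k = k
    iterate (suc n) k = iterate n (advance k)

    iterate-suc : ∀ n k → iterate (suc n) k ≡ advance (iterate n k)
    iterate-suc zero    k = refl
    iterate-suc (suc n) k = iterate-suc n (advance k)

    iterate-+ : ∀ n d k → iterate (n ℕ.+ d) k ≡ iterate d (iterate n k)
    iterate-+ zero    d k = refl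
    iterate-+ (suc n) d k = iterate-+ n d (advance k)

    at : ℕ → Position
    at n = iterate n begin-round

    run : Run x
    run = record
      { node   = λ n → Position.here-node (at n)
      ; act    = λ n → Position.next (at n)
      ; starts = refl
      ; moves  = λ n → subst (λ k → (Position.next (at n) , Position.here-node k) ∈ E (Position.here-node (at n)))
                             (sym (iterate-suc n begin-round)) (advance-edge (at n)) }

    run-in-cycle : ∀ m → Run.act run m ∈ μ ∷ c
    run-in-cycle m with at m
    ... | position ν c' q {pre} eq = subst (ν ∈_) eq (∈-++⁺ʳ pre (here refl))

    round-ends : ∀ k → Position.next (iterate (suc (length (Position.rest k))) k) ≡ μ
    round-ends (position ν rest q eq) = ends ν rest q eq
      where
      ends : ∀ {z pre} ν rest (q : Path z (ν ∷ rest) x) (eq : pre ++ ν ∷ rest ≡ μ ∷ c) →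
             Position.next (iterate (suc (length rest)) (position ν rest q eq)) ≡ μ
      ends ν []         (step e done) eq = refl
      ends ν (ν' ∷ c'') (step e q)    eq = ends ν' c'' q _

    μ-recurs : ∀ k → Σ ℕ λ m → k ≤ m × Run.act run m ≡ μ
    μ-recurs k = k ℕ.+ suc (length (Position.rest (at k))) , ℕP.m≤m+n k _ ,
      trans (cong Position.next (iterate-+ k (suc (length (Position.rest (at k)))) begin-round))
            (round-ends (at k))

  -- Stuck nodes, and maximal continuations: from every node there is either
  -- a path into a stuck node or an infinite run (always taking the first edge).
  Stuck-node : Fin N → Set
  Stuck-node z = E z ≡ []

  stuck-node? : ∀ z → Dec (Stuck-node z)
  stuck-node? z with E z
  ... | []    = yes refl
  ... | _ ∷ _ = no λ ()

  module Greedy {y} (never-stuck : ¬ PathTo y Stuck-node) where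
    Reached : Set
    Reached = Σ (Fin N) λ z → Σ (List Act) λ t → Path y t z

    first-edge : (g : Reached) → Σ (Act × Fin N) λ a → a ∈ E (proj₁ g)
    first-edge (z , t , p) with E z in eq
    ... | []    = ⊥-elim (never-stuck (t , z , p , eq))
    ... | a ∷ _ = a , here refl

    reached : ℕ → Reached
    reached zero    = y , [] , done
    reached (suc n) with reached n | first-edge (reached n)
    ... | z , t , p | (μ , z') , e = z' , t ++ (μ ∷ []) , p ++ᴾ step e done

    run : Run y
    run = record { node = λ n → proj₁ (reached n) ; act = λ n → proj₁ (proj₁ (first-edge (reached n)))
                 ; starts = refl ; moves = λ n → proj₂ (first-edge (reached n)) }

  stuck-or-run : ∀ y → PathTo y Stuck-node ⊎ Run y
  stuck-or-run y with path-to? y stuck-node?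
  ... | yes stuck = inj₁ stuck
  ... | no ¬stuck = inj₂ (Greedy.run ¬stuck)

  -- from y, a short path followed by a short non-empty cycle, all of whose
  -- actions satisfy P: the finite shape of a run satisfying P forever
  Lasso : (Act → Set) → Fin N → Set
  Lasso P y = Bounded y N (λ s z → All P s × Bounded z N (λ c z' → z' ≡ z × 1 ≤ length c × All P c))

  lasso? : ∀ {P : Act → Set} → (∀ μ → Dec (P μ)) → ∀ y → Dec (Lasso P y)
  lasso? P? y = bounded? N y (λ s z → All.all? P? s ×-dec
                  bounded? N z (λ c z' → (z' FP.≟ z) ×-dec ((1 ℕ.≤? length c) ×-dec All.all? P? c)))

  tail-lasso : ∀ {x} (r : Run x) {P : Act → Set} k → (∀ m → k ≤ m → P (Run.act r m)) → Lasso P (Run.node r k)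
  tail-lasso r {P} k late =
    segment act k i , _ , stem , fits i (ℕP.≤-trans (ℕP.m≤m+n i d) within) , segment-all act k late i ,
    (segment act (k ℕ.+ i) d , _ , cycle , fits d (ℕP.≤-trans (ℕP.m≤n+m d i) within) , refl ,
     subst (1 ≤_) (sym (segment-length act (k ℕ.+ i) d)) cycle-non-empty ,
     segment-all act (k ℕ.+ i) (λ m le → late m (ℕP.≤-trans (ℕP.m≤m+n k i) le)) d)
    where
    open Run r
    open Window (window r k)
    fits : ∀ {j} n → n ≤ N → length (segment act j n) ≤ N
    fits {j} n le = subst (_≤ N) (sym (segment-length act j n)) le

  lasso-run : ∀ {P : Act → Set} {y} → Lasso P y → Σ (Run y) λ r → ∀ m → P (Run.act r m)
  lasso-run (s , z , p , _ , ps , (ν ∷ c , .z , q , _ , refl , _ , pc)) =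
    prepend p (Cycling.run q) ,
    prepend-all p (Cycling.run q) ps (λ m → All.lookup pc (Cycling.run-in-cycle q m))

module Actions where
  import Data.Product.Properties as ×P

  code : Act → ℕ × ℕ
  code ⟨ a ,ε⟩   = 0 , a
  code (syncL a) = 1 , a
  code ⟨ε, a ⟩   = 2 , a
  code (syncR a) = 3 , a
  code ⟨~ a ,ε⟩  = 4 , a
  code ⟨ε,~ a ⟩  = 5 , a

  decode : ℕ × ℕ → Act
  decode (0 , a) = ⟨ a ,ε⟩
  decode (1 , a) = syncL a
  decode (2 , a) = ⟨ε, a ⟩
  decode (3 , a) = syncR a
  decode (4 , a) = ⟨~ a ,ε⟩
  decode (_ , a) = ⟨ε,~ a ⟩

  decode-code : ∀ μ → decode (code μ) ≡ μ
  decode-code ⟨ a ,ε⟩   = refl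
  decode-code (syncL a) = refl
  decode-code ⟨ε, a ⟩   = refl
  decode-code (syncR a) = refl
  decode-code ⟨~ a ,ε⟩  = refl
  decode-code ⟨ε,~ a ⟩  = refl

  _≟ᴬ_ : (μ ν : Act) → Dec (μ ≡ ν)
  μ ≟ᴬ ν = map′ (λ eq → trans (sym (decode-code μ)) (trans (cong decode eq) (decode-code ν))) (cong code)
                (×P.≡-dec ℕ._≟_ ℕ._≟_ (code μ) (code ν))

  rel? : ∀ a μ → Dec (Rel a μ)
  rel? a μ = (μ ≟ᴬ ⟨ a ,ε⟩) ⊎-dec (μ ≟ᴬ ⟨ε,~ a ⟩)

  ServerInput : Act → Set
  ServerInput μ = Σ Name λ b → μ ≡ ⟨ε, b ⟩

  serverInput? : ∀ μ → Dec (ServerInput μ)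
  serverInput? ⟨ε, b ⟩   = yes (b , refl)
  serverInput? ⟨ a ,ε⟩   = no λ ()
  serverInput? (syncL a) = no λ ()
  serverInput? (syncR a) = no λ ()
  serverInput? ⟨~ a ,ε⟩  = no λ ()
  serverInput? ⟨ε,~ a ⟩  = no λ ()

  nameOf : Act → Name
  nameOf μ = proj₂ (code μ)

  cEff-other : ∀ a μ → nameOf μ ≢ a → cEff a μ ≡ + 0
  cEff-other a ⟨ b ,ε⟩ ne with a ℕ.≟ b
  ... | yes a≡b = ⊥-elim (ne (sym a≡b))
  ... | no _    = refl
  cEff-other a ⟨ε,~ b ⟩ ne with a ℕ.≟ b
  ... | yes a≡b = ⊥-elim (ne (sym a≡b))
  ... | no _    = refl
  cEff-other a (syncL b) ne = refl
  cEff-other a ⟨ε, b ⟩   ne = refl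
  cEff-other a (syncR b) ne = refl
  cEff-other a ⟨~ b ,ε⟩  ne = refl

  sEff-other : ∀ a μ → nameOf μ ≢ a → sEff a μ ≡ + 0
  sEff-other a ⟨ε, b ⟩ ne with a ℕ.≟ b
  ... | yes a≡b = ⊥-elim (ne (sym a≡b))
  ... | no _    = refl
  sEff-other a ⟨~ b ,ε⟩ ne with a ℕ.≟ b
  ... | yes a≡b = ⊥-elim (ne (sym a≡b))
  ... | no _    = refl
  sEff-other a (syncL b) ne = refl
  sEff-other a ⟨ b ,ε⟩   ne = refl
  sEff-other a (syncR b) ne = refl
  sEff-other a ⟨ε,~ b ⟩  ne = refl

  balance-zero : ∀ (w : Act → ℤ) s → All (λ μ → w μ ≡ + 0) s → balance w s ≡ + 0
  balance-zero w []      []       = refl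
  balance-zero w (μ ∷ s) (z ∷ zs) = cong₂ ℤ._+_ z (balance-zero w s zs)

module _ {P : Act → Set} where
  all-inner : ∀ μ (s₁ s₂ s₃ : List Act) → All P (μ ∷ (s₁ ++ (s₂ ++ s₃))) → All P s₂
  all-inner μ s₁ s₂ s₃ (_ ∷ ps) = AllP.++⁻ˡ s₂ (AllP.++⁻ʳ s₁ ps)

  all-outer : ∀ μ (s₁ s₂ s₃ : List Act) → All P (μ ∷ (s₁ ++ (s₂ ++ s₃))) → All P (μ ∷ (s₁ ++ s₃))
  all-outer μ s₁ s₂ s₃ (p ∷ ps) = p ∷ AllP.++⁺ (AllP.++⁻ˡ s₁ ps) (AllP.++⁻ʳ s₂ (AllP.++⁻ʳ s₁ ps))

∈-outer : ∀ {ν : Act} μ (s₁ s₂ s₃ : List Act) →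
          ν ∈ μ ∷ (s₁ ++ (s₂ ++ s₃)) → ν ∉ s₂ → ν ∈ μ ∷ (s₁ ++ s₃)
∈-outer μ s₁ s₂ s₃ (here eq) _ = here eq
∈-outer μ s₁ s₂ s₃ (there m) ν∉s₂ with ∈-++⁻ s₁ m
... | inj₁ m₁ = there (∈-++⁺ˡ m₁)
... | inj₂ m' with ∈-++⁻ s₂ m'
...   | inj₁ m₂ = ⊥-elim (ν∉s₂ m₂)
...   | inj₂ m₃ = there (∈-++⁺ʳ s₁ m₃)

take-length-++ : ∀ (s t : List Act) → take (length s) (s ++ t) ≡ s
take-length-++ []      t = refl
take-length-++ (μ ∷ s) t = cong (μ ∷_) (take-length-++ s t)

module Conditions (N : ℕ) (E : Fin N → List (Act × Fin N)) (st : Fin N) where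
  open Runs N E st public
  open Actions
  open import Data.List.Membership.DecPropositional _≟ᴬ_ using () renaming (_∈?_ to _∈ᴬ?_)

  GraphRespectful : Set
  GraphRespectful = (∀ {s y} → Path st s y → Stuck-node y → RespectfulL s)
                  × (∀ (r : Run st) → RespectfulI (Run.act r))

  Untouched : Name → Act → Set
  Untouched a μ = ¬ Rel a μ

  UnansweredInput : Name → List Act → Set
  UnansweredInput a c = ⟨ a ,ε⟩ ∈ c × All (_≢ ⟨ε,~ a ⟩) c

  ServerInputsOnly : List Act → Set
  ServerInputsOnly c = 1 ≤ length c × All ServerInput c

  split-unanswered : ∀ a → SplitStable (UnansweredInput a)
  split-unanswered a μ s₁ s₂ s₃ (input , no-output) with ⟨ a ,ε⟩ ∈ᴬ? s₂
  ... | yes inner = inj₁ (inner , all-inner μ s₁ s₂ s₃ no-output)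
  ... | no ¬inner = inj₂ (∈-outer μ s₁ s₂ s₃ input ¬inner , all-outer μ s₁ s₂ s₃ no-output)

  split-serverInputs : SplitStable ServerInputsOnly
  split-serverInputs μ s₁ s₂ s₃ (_ , inputs) = inj₂ (s≤s z≤n , all-outer μ s₁ s₂ s₃ inputs)

  -- the conditions concerning one name a: C1 (c-sound, s-sound), C2, C3, C4
  record NameConditions (a : Name) : Set where
    field
      c-sound       : NonNegative (cEff a)
      s-sound       : NonNegative (sEff a)
      stuck-zero    : ZeroInto Stuck-node (cEff a)
      lasso-zero    : ZeroInto (Lasso (Untouched a)) (cEff a)
      no-unanswered : ¬ ReachableCycle (UnansweredInput a)

  -- C1–C4 for every name, and C5
  record Conditions : Set where
    field
      per-name        : ∀ a → NameConditions a
      no-server-cycle : ¬ ReachableCycle ServerInputsOnly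

  module Sufficient (conditions : Conditions) where
    open Conditions conditions
    open module PerName a = NameConditions (per-name a)

    finite-respectful : ∀ {s y} → Path st s y → Stuck-node y → RespectfulL s
    finite-respectful p stuck =
      (λ a n _ → let q = proj₂ (take-path p n) in c-sound a q , s-sound a q) ,
      (λ a → stuck-zero a p stuck)

    module _ (r : Run st) where
      open Run r

      run-sound : SoundI act
      run-sound a n = c-sound a (prefix-path r n) , s-sound a (prefix-path r n)

      -- ↾a finite: the run from the last occurrence on is an a-free lasso
      finite-restriction-zero : ∀ a k → (∀ m → k ≤ m → ¬ Rel a (act m)) → cVal a (prefix act k) ≡ + 0
      finite-restriction-zero a k free = lasso-zero a (prefix-path r k) (tail-lasso r k free)

      -- ↾a infinite but eventually ⟨a,ε⟩ only: some node repeats between two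
      -- occurrences, closing a cycle with an unanswered input
      infinite-restriction : ∀ a → ¬ RestrFinite a act → ¬ RestrDefinitelyIn a act
      infinite-restriction a infinite (k , only-inputs) =
        Pigeonhole.recurrent-repeat node (λ m → Rel a (act m)) k infinite λ m₁ m₂ k≤m₁ m₁<m₂ rel eq →
          no-unanswered a (short-cycle (split-unanswered a) (prefix-path r m₁) (repeat-cycle r m₁<m₂ eq)
            (subst (_∈ segment act m₁ (m₂ ℕ.∸ m₁)) (only-inputs m₁ k≤m₁ rel)
                   (segment-head act m₁ (m₂ ℕ.∸ m₁) (ℕP.m<n⇒0<n∸m m₁<m₂)) ,
             segment-all act m₁ (λ m le → no-output m (ℕP.≤-trans k≤m₁ le)) (m₂ ℕ.∸ m₁)))
        where
        no-output : ∀ m → k ≤ m → act m ≢ ⟨ε,~ a ⟩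
        no-output m k≤m eq with only-inputs m k≤m (inj₂ eq)
        ... | eq' = case (trans (sym eq) eq')
          where
          case : ⟨ε,~ a ⟩ ≢ ⟨ a ,ε⟩
          case ()

      -- server inputs forever would give a reachable server-input cycle
      not-server-inputs-forever : NonDefServerInput act
      not-server-inputs-forever (k , inputs) with tail-lasso r k inputs
      ... | s , z , p , _ , _ , (c , .z , q , _ , refl , non-empty , all-inputs) =
        no-server-cycle (short-cycle split-serverInputs (prefix-path r k ++ᴾ p) q (non-empty , all-inputs))

      infinite-respectful : RespectfulI act
      infinite-respectful = run-sound , (λ a → finite-restriction-zero a , infinite-restriction a) ,
                            not-server-inputs-forever

    graph-respectful : GraphRespectful
    graph-respectful = finite-respectful , infinite-respectful

  module Necessary (respectful : GraphRespectful) where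
    private
      finite   = proj₁ respectful
      infinite = proj₂ respectful

    maximal-extension : ∀ {s y} → Path st s y →
                        (Σ (List Act) λ t → Σ (Fin N) λ z → Path st (s ++ t) z × Stuck-node z)
                      ⊎ (Σ (Run st) λ r → prefix (Run.act r) (length s) ≡ s)
    maximal-extension {s} {y} p with stuck-or-run y
    ... | inj₁ (t , z , q , stuck) = inj₁ (t , z , p ++ᴾ q , stuck)
    ... | inj₂ r                   = inj₂ (prepend p r , prepend-prefix p r)

    nonNegative : ∀ (w : Act → ℤ) →
                  (∀ {s} → RespectfulL s → ∀ n → n ≤ length s → + 0 ℤ.≤ balance w (take n s)) →
                  (∀ {g} → RespectfulI g → ∀ n → + 0 ℤ.≤ balance w (prefix g n)) → NonNegative w
    nonNegative w fin inf {s} p with maximal-extension p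
    ... | inj₁ (t , z , q , stuck) =
      subst (λ l → + 0 ℤ.≤ balance w l) (take-length-++ s t)
            (fin (finite q stuck) (length s) (subst (length s ≤_) (sym (LP.length-++ s)) (ℕP.m≤m+n _ _)))
    ... | inj₂ (r , eq) = subst (λ l → + 0 ℤ.≤ balance w l) eq (inf (infinite r) (length s))

    -- continue the path by the a-free run of the lasso: ↾a is then finite
    lasso-balanced : ∀ a → ZeroInto (Lasso (Untouched a)) (cEff a)
    lasso-balanced a {s} p lasso with lasso-run lasso
    ... | r , free = subst (λ l → cVal a l ≡ + 0) (prepend-prefix p r)
                           (proj₁ (proj₁ (proj₂ (infinite (prepend p r))) a) (length s) (prepend-tail p r {Untouched a} free))

    -- rotate the cycle to start with ⟨a,ε⟩ and go around it forever: ↾a is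
    -- then infinite, but eventually consists of ⟨a,ε⟩ only
    no-unanswered-cycle : ∀ a → ¬ ReachableCycle (UnansweredInput a)
    no-unanswered-cycle a (s , x , p , _ , c , .x , q , _ , refl , input , no-output) with ∈-∃++ input
    ... | c₁ , c₂ , refl with rotate c₁ q
    ... | z , q₁ , rotated = proj₂ (proj₁ (proj₂ (infinite run)) a) occurs-forever only-inputs
      where
      no-output' : All (_≢ ⟨ε,~ a ⟩) (⟨ a ,ε⟩ ∷ (c₂ ++ c₁))
      no-output' = (λ ()) ∷ AllP.++⁺ (All.tail (AllP.++⁻ʳ c₁ no-output)) (AllP.++⁻ˡ c₁ no-output)
      run : Run st
      run = prepend (p ++ᴾ q₁) (Cycling.run rotated)
      occurs-forever : ¬ RestrFinite a (Run.act run)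
      occurs-forever (k , absent)
        with prepend-often (p ++ᴾ q₁) (Cycling.run rotated) {_≡ ⟨ a ,ε⟩} (Cycling.μ-recurs rotated) k
      ... | m , le , eq = absent m le (inj₁ eq)
      input-only : ∀ {μ} → μ ≢ ⟨ε,~ a ⟩ → Rel a μ → μ ≡ ⟨ a ,ε⟩
      input-only _  (inj₁ eq) = eq
      input-only ne (inj₂ eq) = ⊥-elim (ne eq)
      only-inputs : RestrDefinitelyIn a (Run.act run)
      only-inputs = length (s ++ c₁) , prepend-tail (p ++ᴾ q₁) (Cycling.run rotated) {λ μ → Rel a μ → μ ≡ ⟨ a ,ε⟩}
                      (λ m → input-only (All.lookup no-output' (Cycling.run-in-cycle rotated m)))

    name-conditions : ∀ a → NameConditions a
    name-conditions a = record
      { c-sound       = nonNegative (cEff a) (λ resp n le → proj₁ (proj₁ resp a n le)) (λ resp n → proj₁ (proj₁ resp a n))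
      ; s-sound       = nonNegative (sEff a) (λ resp n le → proj₂ (proj₁ resp a n le)) (λ resp n → proj₂ (proj₁ resp a n))
      ; stuck-zero    = λ p stuck → proj₂ (finite p stuck) a
      ; lasso-zero    = lasso-balanced a
      ; no-unanswered = no-unanswered-cycle a }

    -- going around a server-input cycle forever contradicts respectfulness
    no-server-cycle : ¬ ReachableCycle ServerInputsOnly
    no-server-cycle (s , x , p , _ , ν ∷ c , .x , q , _ , refl , _ , inputs) =
      proj₂ (proj₂ (infinite (prepend p (Cycling.run q))))
        (length s , prepend-tail p (Cycling.run q) {ServerInput} (λ m → All.lookup inputs (Cycling.run-in-cycle q m)))

    conditions : Conditions
    conditions = record { per-name = name-conditions ; no-server-cycle = no-server-cycle }

  -- Only the finitely many names on edges matter: for any other name all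
  -- balances vanish, so the conditions for it hold trivially.

  names : List Name
  names = concatMap (λ j → map (nameOf ∘ proj₁) (E j)) (allFin N)

  edge-name : ∀ {x μ y} → (μ , y) ∈ E x → nameOf μ ∈ names
  edge-name {x} e = ∈-concatMap⁺ (λ j → map (nameOf ∘ proj₁) (E j))
                      (Any.map (λ { refl → ∈-map⁺ (nameOf ∘ proj₁) e }) (∈-allFin x))

  path-names : ∀ {x s y} → Path x s y → All (λ μ → nameOf μ ∈ names) s
  path-names done       = []
  path-names (step e p) = edge-name e ∷ path-names p

  absent-name : ∀ a → a ∉ names → NameConditions a
  absent-name a a∉ = record
    { c-sound       = λ p → ℤP.≤-reflexive (sym (c-zero p))
    ; s-sound       = λ p → ℤP.≤-reflexive (sym (s-zero p))
    ; stuck-zero    = λ p _ → c-zero p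
    ; lasso-zero    = λ p _ → c-zero p
    ; no-unanswered = λ { (_ , _ , _ , _ , _ , _ , q , _ , refl , input , _) → a∉ (All.lookup (path-names q) input) } }
    where
    other : ∀ {μ} → nameOf μ ∈ names → nameOf μ ≢ a
    other m eq = a∉ (subst (_∈ names) eq m)
    c-zero : ∀ {x s y} → Path x s y → balance (cEff a) s ≡ + 0
    c-zero p = balance-zero (cEff a) _ (All.map (λ {μ} m → cEff-other a μ (other {μ} m)) (path-names p))
    s-zero : ∀ {x s y} → Path x s y → balance (sEff a) s ≡ + 0
    s-zero p = balance-zero (sEff a) _ (All.map (λ {μ} m → sEff-other a μ (other {μ} m)) (path-names p))

  nameConditions? : ∀ a → Dec (NameConditions a)
  nameConditions? a =
    map′ (λ (cs , ss , sz , lz , nu) → record { c-sound = cs ; s-sound = ss ; stuck-zero = sz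
                                              ; lasso-zero = lz ; no-unanswered = nu })
         (λ c → let open NameConditions c
                in (λ {_} {_} → c-sound) , (λ {_} {_} → s-sound) , (λ {_} {_} → stuck-zero) ,
                   (λ {_} {_} → lasso-zero) , no-unanswered)
         (nonNegative? (cEff a) ×-dec nonNegative? (sEff a) ×-dec zeroInto? stuck-node? (cEff a)
          ×-dec zeroInto? (lasso? (¬? ∘ rel? a)) (cEff a)
          ×-dec ¬? (reachable-cycle? (λ c → (⟨ a ,ε⟩ ∈ᴬ? c) ×-dec All.all? (λ μ → ¬? (μ ≟ᴬ ⟨ε,~ a ⟩)) c)))

  conditions? : Dec Conditions
  conditions? =
    map′ (λ (pn , ns) → record { per-name = pn ; no-server-cycle = ns })
         (λ c → Conditions.per-name c , Conditions.no-server-cycle c)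
         (all-names ×-dec ¬? (reachable-cycle? (λ c → (1 ℕ.≤? length c) ×-dec All.all? serverInput? c)))
    where
    all-names : Dec (∀ a → NameConditions a)
    all-names with All.all? nameConditions? names
    ... | yes listed = yes λ a → case (a ∈ℕ? names) listed
      where
      open import Data.List.Membership.DecPropositional ℕ._≟_ using () renaming (_∈?_ to _∈ℕ?_)
      case : ∀ {a} → Dec (a ∈ names) → All NameConditions names → NameConditions a
      case (yes a∈) listed = All.lookup listed a∈
      case {a} (no a∉) _   = absent-name a a∉
    ... | no ¬listed = no λ all → ¬listed (All.tabulate (λ {a} _ → all a))

  graphRespectful? : Dec GraphRespectful
  graphRespectful? = map′ Sufficient.graph-respectful Necessary.conditions conditions?

module Bridge (f : Tm 0) (wf : WF f) where
  open OrchestratorGraph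
  open FiniteGraph f wf
  open Conditions size edges root

  trace-path : ∀ {x s g} → ⟦ x ⟧ —[ s ]→* g → Σ (Fin size) λ y → Path x s y × g ≡ ⟦ y ⟧
  trace-path done = _ , done , refl
  trace-path (step d tr) with edges-complete d
  ... | k , e , refl with trace-path tr
  ...   | y , p , eq = y , step e p , eq

  path-trace : ∀ {x s y} → Path x s y → ⟦ x ⟧ —[ s ]→* ⟦ y ⟧
  path-trace done       = done
  path-trace (step e p) = step (edges-sound e) (path-trace p)

  stuck⇒stuck-node : ∀ {y} → Stuck ⟦ y ⟧ → Stuck-node y
  stuck⇒stuck-node {y} stuck with edges y in eq
  ... | []          = refl
  ... | (μ , z) ∷ _ = ⊥-elim (stuck (μ , ⟦ z ⟧ , edges-sound (subst ((μ , z) ∈_) (sym eq) (here refl))))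

  stuck-node⇒stuck : ∀ {y} → Stuck-node y → Stuck ⟦ y ⟧
  stuck-node⇒stuck {y} stuck (μ , g , d) with edges-complete d
  ... | k , e , _ with subst ((μ , k) ∈_) stuck e
  ...   | ()

  module _ (r : InfRun f) where
    open InfRun r

    step-node : ∀ n j → states n ≡ ⟦ j ⟧ →
                Σ (Fin size) λ k → ((acts n , k) ∈ edges j) × (states (suc n) ≡ ⟦ k ⟧)
    step-node n j eq = edges-complete (subst (λ t → t —[ acts n ]→ states (suc n)) eq (steps n))

    node-of : ∀ n → Σ (Fin size) λ j → states n ≡ ⟦ j ⟧
    node-of zero    = root , trans start (sym root-term)
    node-of (suc n) with node-of n
    ... | j , eq = proj₁ (step-node n j eq) , proj₂ (proj₂ (step-node n j eq))

    graph-run : Run root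
    graph-run = record { node = λ n → proj₁ (node-of n) ; act = acts ; starts = refl
                       ; moves = λ n → proj₁ (proj₂ (step-node n _ (proj₂ (node-of n)))) }

  term-run : Run root → InfRun f
  term-run r = record { states = λ n → ⟦ Run.node r n ⟧ ; acts = Run.act r
                      ; start = trans (cong ⟦_⟧ (Run.starts r)) root-term
                      ; steps = λ n → edges-sound (Run.moves r n) }

  respectful⇒graph : Respectful (orch f wf) → GraphRespectful
  respectful⇒graph (finite , infinite) =
    (λ {s} {y} p stuck → finite s ⟦ y ⟧ (subst (_—[ s ]→* ⟦ y ⟧) root-term (path-trace p))
                                (stuck-node⇒stuck stuck)) ,
    (λ r → infinite (term-run r))

  graph⇒respectful : GraphRespectful → Respectful (orch f wf)
  graph⇒respectful (finite , infinite) =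
    (λ s g tr stuck → let (y , p , eq) = trace-path (subst (_—[ s ]→* g) (sym root-term) tr)
                      in finite p (stuck⇒stuck-node (subst Stuck eq stuck))) ,
    (λ r → infinite (graph-run r))

mainTheorem7 : (f : Orchestrator) → Dec (Respectful f)
mainTheorem7 (orch f wf) = map′ graph⇒respectful respectful⇒graph graphRespectful?
  where
  open OrchestratorGraph.FiniteGraph f wf using (size; edges; root)
  open Conditions size edges root using (graphRespectful?)
  open Bridge f wf using (graph⇒respectful; respectful⇒graph)
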